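{- Let $p$ be a prime and let $f(x)=\sum_{j=0}^n a_j\frac{x^j}{j!}\in\mathbb{Q}[x]$ have degree $n\ge 1$. Suppose $f$ is $p$-Coleman integral. Then: (i) $NP_p(f)=NP_p(E_n)$, where $E_n(x)=\sum_{j=0}^n x^j/j!$; (ii) the breaks of $NP_p(f)$ are precisely the pivotal indices associated to $(n,p)$; (iii) the slopes of $NP_p(f)$ all have denominator (in lowest terms) divisible by $p^{\mathrm{ord}_p(n)}$.
   Context: $\mathrm{ord}_p$ is the $p$-adic valuation, with $\mathrm{ord}_p(0)=\infty$. The $p$-adic Newton polygon $NP_p(g)$ of $g=\sum_{j=0}^n c_jx^j\in\mathbb{Q}[x]$ is the lower convex hull of the points $\{(j,\mathrm{ord}_p(c_j)):0\le j\le n\}$; its breaks are the $x$-coordinates of its vertices (including the endpoints). Pivotal indices: write $n=b_1p^{e_1}+\cdots+b_sp^{e_s}$ with $0<b_i<p$ and $e_1>e_2>\cdots>e_s\geq 0$; the pivotal indices associated to $(n,p)$ are $k_i=b_1p^{e_1}+\cdots+b_ip^{e_i}$ for $i=0,\dots,s$ (so $k_0=0$, $k_s=n$). A polynomial $f=\sum_{j=0}^n a_j x^j/j!\in\mathbb{Q}[x]$ is $p$-Hurwitz integral if $\mathrm{ord}_p(a_j)\ge 0$ for all $j$, and $p$-Coleman integral if it is $p$-Hurwitz integral and moreover $\mathrm{ord}_p(a_{k_i})=0$ for all pivotal indices $k_i$, $i=0,\dots,s$. -}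

module Defs where

open import Data.Nat as ℕ using (ℕ; zero; suc; _^_; _!)
open import Data.Nat.Properties using (_!≢0)
open import Data.Nat.Divisibility using (_∣?_)
open import Data.Nat.DivMod using (_/_)
open import Data.Integer as ℤ using (ℤ; +_; ∣_∣)
open import Data.Rational as ℚ using (ℚ; ↥_; ↧ₙ_)
open import Data.List using (List; []; _∷_; map; take; length)
open import Data.Nat.ListAction using (sum)
open import Data.List.Relation.Unary.All using (All)
open import Data.List.Relation.Binary.Pointwise using ()
open import Data.List.Relation.Unary.Linked using (Linked)
open import Data.Product using (Σ; ∃; ∃-syntax; _×_; _,_; proj₁; proj₂)
open import Relation.Nullary using (¬_; yes; no)
open import Relation.Binary.PropositionalEquality using (_≡_; _≢_)
open import Function.Bundles using (_⇔_)

-- νgo fuel p m : exponent of p in m (for p ≥ 2, m ≥ 1; junk 0 otherwise).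
-- Fuel m suffices since m / p < m.
νgo : ℕ → ℕ → ℕ → ℕ
νgo zero p m = 0
νgo (suc f) p zero = 0
νgo (suc f) zero (suc m) = 0
νgo (suc f) (suc zero) (suc m) = 0
νgo (suc f) (suc (suc q)) (suc m) with suc (suc q) ∣? suc m
... | yes _ = suc (νgo f (suc (suc q)) (suc m / suc (suc q)))
... | no _ = 0

νℕ : ℕ → ℕ → ℕ
νℕ p m = νgo m p m

-- ord_p on ℚ (meaningful only for q ≢ 0; ord_p(0) = ∞ is handled by
-- always guarding uses with q ≢ 0)
ordℚ : ℕ → ℚ → ℤ
ordℚ p q = (+ νℕ p ∣ ↥ q ∣) ℤ.- (+ νℕ p (↧ₙ q))

ℕ→ℚ : ℕ → ℚ
ℕ→ℚ n = (+ n) ℚ./ 1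

ℤ→ℚ : ℤ → ℚ
ℤ→ℚ z = z ℚ./ 1

-- Newton polygon of g = Σ_{j ≤ n} c j x^j  (coefficients c : ℕ → ℚ,
-- only j ≤ n are used)

vert : ℕ → (ℕ → ℚ) → ℕ → ℚ
vert p c j = ℤ→ℚ (ordℚ p (c j))

-- (x , y) lies on a segment joining two points (i, ord c_i), (k, ord c_k)
-- with c_i, c_k ≠ 0 (points with ord = ∞ are omitted)
SegPoint : ℕ → (ℕ → ℚ) → ℕ → ℚ → ℚ → Set
SegPoint p c n x y =
  Σ ℕ λ i → Σ ℕ λ k → Σ ℚ λ t →
    (i ℕ.≤ n) × (k ℕ.≤ n) × (c i ≢ 0ℚ') × (c k ≢ 0ℚ') ×
    (ℚ.0ℚ ℚ.≤ t) × (t ℚ.≤ ℚ.1ℚ) ×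
    (x ≡ (ℚ.1ℚ ℚ.- t) ℚ.* ℕ→ℚ i ℚ.+ t ℚ.* ℕ→ℚ k) ×
    (y ≡ (ℚ.1ℚ ℚ.- t) ℚ.* vert p c i ℚ.+ t ℚ.* vert p c k)
  where 0ℚ' = ℚ.0ℚ

-- NP_p(g)(x) = y : the lower convex hull of the points, evaluated at x,
-- has value y (minimum over the vertical line of the convex hull).
NPValue : ℕ → (ℕ → ℚ) → ℕ → ℚ → ℚ → Set
NPValue p c n x y =
  SegPoint p c n x y × (∀ y' → SegPoint p c n x y' → y ℚ.≤ y')

SameNP : ℕ → (ℕ → ℚ) → (ℕ → ℚ) → ℕ → Set
SameNP p c d n = ∀ x y → NPValue p c n x y ⇔ NPValue p d n x y

-- j is a break (the x-coordinate of a vertex) of NP_p(g): the point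
-- (j, ord c_j) is a vertex of the lower convex hull, i.e. it is exposed by a
-- non-vertical line lying strictly below all other points.
IsBreak : ℕ → (ℕ → ℚ) → ℕ → ℕ → Set
IsBreak p c n j =
  (j ℕ.≤ n) × (c j ≢ ℚ.0ℚ) ×
  Σ ℚ λ m → ∀ i → i ℕ.≤ n → c i ≢ ℚ.0ℚ → i ≢ j →
    vert p c j ℚ.+ m ℚ.* (ℕ→ℚ i ℚ.- ℕ→ℚ j) ℚ.< vert p c i

ConsecutiveBreaks : ℕ → (ℕ → ℚ) → ℕ → ℕ → ℕ → Set
ConsecutiveBreaks p c n b b' =
  IsBreak p c n b × IsBreak p c n b' × (b ℕ.< b') ×
  (∀ j → b ℕ.< j → j ℕ.< b' → ¬ IsBreak p c n j)

-- polynomials written as f = Σ a_j x^j / j!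

hcoeff : (ℕ → ℚ) → ℕ → ℚ
hcoeff a j = a j ℚ.* ((+ 1) ℚ./ (j !)) {{j !≢0}}

-- coefficients a_j of E_n = Σ_{j ≤ n} x^j / j!
Ecoeff : ℕ → ℚ
Ecoeff j = ℚ.1ℚ

repValue : ℕ → List (ℕ × ℕ) → ℕ
repValue p bs = sum (map (λ be → proj₁ be ℕ.* p ^ proj₂ be) bs)

IsBaseRep : ℕ → ℕ → List (ℕ × ℕ) → Set
IsBaseRep n p bs =
  All (λ be → (0 ℕ.< proj₁ be) × (proj₁ be ℕ.< p)) bs ×
  Linked (λ be be' → proj₂ be' ℕ.< proj₂ be) bs ×
  (repValue p bs ≡ n)

IsPivotal : ℕ → ℕ → ℕ → Set
IsPivotal n p k =
  Σ (List (ℕ × ℕ)) λ bs → IsBaseRep n p bs ×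
    Σ ℕ λ i → (i ℕ.≤ length bs) × (k ≡ repValue p (take i bs))

HurwitzIntegral : ℕ → ℕ → (ℕ → ℚ) → Set
HurwitzIntegral p n a =
  ∀ j → j ℕ.≤ n → a j ≢ ℚ.0ℚ → + 0 ℤ.≤ ordℚ p (a j)

ColemanIntegral : ℕ → ℕ → (ℕ → ℚ) → Set
ColemanIntegral p n a =
  HurwitzIntegral p n a ×
  (∀ k → IsPivotal n p k → (a k ≢ ℚ.0ℚ) × (ordℚ p (a k) ≡ + 0))

{-# OPTIONS --safe #-}
module Submission where

-- By Legendre's formula (p - 1) ord_p(j!) = j - s_p(j), where s_p is the base-p digit sum, the points
-- of NP_p(E_n) are (j , (s_p(j) - j) / (p - 1)). Let n = Σ b_i p^(e_i) have pivotal indices k_i.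
-- Passing from k_i to k_(i+1) = k_i + b_i p^(e_i) raises s_p by b_i, so the chord between these two
-- points has slope μ_i = (1 - p^(e_i)) / ((p - 1) p^(e_i)); the digit-sum inequality
-- p^(e_i) s_p(k_i) + j ≤ p^(e_i) s_p(j) + k_i, valid for j < k_i + p^(e_i + 1), says that the whole line
-- lies below every point. Since the e_i decrease, the μ_i increase, so the chords form a convex
-- polygon touching the points exactly at the k_i. Coleman integrality puts every point of f on or
-- above the corresponding point of E_n (as ord_p(a_j) ≥ 0) and on it at the pivotal indices, so this
-- polygon is NP_p(f) as well, with breaks exactly at the k_i. Finally p^(e_i) divides the
-- denominator of μ_i, and ord_p(n) ≤ e_i for every i.

open import Defs
open import Data.Nat.Base using (ℕ; suc)
import Data.Nat.Base as ℕ
open import Data.Nat.Primality using (Prime)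
open import Data.Rational.Base using (ℚ)

module Valuation (q : ℕ) where
  open import Data.Nat
  open import Data.Nat.Properties
  open import Data.Nat.Divisibility
  open import Data.Nat.DivMod
  open import Data.Nat.Induction using (<-rec)
  open import Data.Nat.Primality using (euclidsLemma)
  open import Data.Nat.Tactic.RingSolver using (solve-∀)
  open import Data.Product using (∃₂; _×_; _,_)
  open import Data.Sum using ([_,_]′)
  open import Data.Empty using (⊥-elim)
  open import Relation.Nullary using (¬_; yes; no)
  open import Relation.Binary.PropositionalEquality

  ^-monoʳ-∣ : ∀ m {e f} → e ≤ f → m ^ e ∣ m ^ f
  ^-monoʳ-∣ m {e} {f} e≤f = divides (m ^ (f ∸ e)) (begin
    m ^ f                 ≡⟨ cong (m ^_) (m+[n∸m]≡n e≤f) ⟨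
    m ^ (e + (f ∸ e))     ≡⟨ ^-distribˡ-+-* m e (f ∸ e) ⟩
    m ^ e * m ^ (f ∸ e)   ≡⟨ *-comm (m ^ e) _ ⟩
    m ^ (f ∸ e) * m ^ e   ∎)
    where open ≡-Reasoning

  -- Parametrising by q with p = 2 + q lets νgo, which matches on p, compute.
  p : ℕ
  p = suc (suc q)

  [1+m]/p<1+m : ∀ m → suc m / p < suc m
  [1+m]/p<1+m m = m/n<m (suc m) p (s≤s (s≤s z≤n))

  private
    m<p*m : ∀ {m} → 1 ≤ m → m < p * m
    m<p*m {m} 1≤m = m<m+n m (<-≤-trans 1≤m (m≤m+n m (q * m)))

    p∤u⇒1≤u : ∀ {u} → ¬ (p ∣ u) → 1 ≤ u
    p∤u⇒1≤u {zero}  p∤u = ⊥-elim (p∤u (p ∣0))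
    p∤u⇒1≤u {suc u} _   = s≤s z≤n

    νgo-∣ : ∀ f m → p ∣ suc m → νgo (suc f) p (suc m) ≡ suc (νgo f p (suc m / p))
    νgo-∣ f m p∣m with p ∣? suc m
    ... | yes _  = refl
    ... | no p∤m = ⊥-elim (p∤m p∣m)

    νgo-∤ : ∀ f m → ¬ (p ∣ suc m) → νgo (suc f) p (suc m) ≡ 0
    νgo-∤ f m p∤m with p ∣? suc m
    ... | yes p∣m = ⊥-elim (p∤m p∣m)
    ... | no _    = refl

    νgo-fuel : ∀ f g m → m ≤ f → m ≤ g → νgo f p m ≡ νgo g p m
    νgo-fuel zero    zero    m       _   _   = refl
    νgo-fuel zero    (suc g) zero    _   _   = refl
    νgo-fuel (suc f) zero    zero    _   _   = refl
    νgo-fuel (suc f) (suc g) zero    _   _   = refl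
    νgo-fuel (suc f) (suc g) (suc m) m≤f m≤g with p ∣? suc m
    ... | yes _ = cong suc (νgo-fuel f g (suc m / p)
                    (<⇒≤pred (<-≤-trans ([1+m]/p<1+m m) m≤f)) (<⇒≤pred (<-≤-trans ([1+m]/p<1+m m) m≤g)))
    ... | no _  = refl

  νℕ[p*m]≡1+νℕ[m] : ∀ m → 1 ≤ m → νℕ p (p * m) ≡ suc (νℕ p m)
  νℕ[p*m]≡1+νℕ[m] m 1≤m = unfold (p * m) refl
    where
    unfold : ∀ n → n ≡ p * m → νℕ p n ≡ suc (νℕ p m)
    unfold zero    n≡pm = ⊥-elim (<⇒≱ (m<p*m 1≤m) (≤-trans (≤-reflexive (sym n≡pm)) z≤n))
    unfold (suc n) n≡pm = begin
      νgo (suc n) p (suc n)      ≡⟨ νgo-∣ n n (divides m n≡mp) ⟩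
      suc (νgo n p (suc n / p))  ≡⟨ cong (λ x → suc (νgo n p x)) n/p≡m ⟩
      suc (νgo n p m)            ≡⟨ cong suc (νgo-fuel n m m m≤n ≤-refl) ⟩
      suc (νℕ p m)               ∎
      where
      open ≡-Reasoning
      n≡mp : suc n ≡ m * p
      n≡mp = trans n≡pm (*-comm p m)
      n/p≡m : suc n / p ≡ m
      n/p≡m = trans (cong (_/ p) n≡mp) (m*n/n≡m m p)
      m≤n : m ≤ n
      m≤n = ≤-pred (<-≤-trans (m<p*m 1≤m) (≤-reflexive (sym n≡pm)))

  νℕ[p^v*u]≡v : ∀ v u → ¬ (p ∣ u) → νℕ p (p ^ v * u) ≡ v
  νℕ[p^v*u]≡v zero zero    p∤u = ⊥-elim (p∤u (p ∣0))
  νℕ[p^v*u]≡v zero (suc u) p∤u = trans (cong (νℕ p) (*-identityˡ (suc u))) (νgo-∤ u u p∤u)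
  νℕ[p^v*u]≡v (suc v) u p∤u = begin
    νℕ p (p * p ^ v * u)    ≡⟨ cong (νℕ p) (*-assoc p (p ^ v) u) ⟩
    νℕ p (p * (p ^ v * u))  ≡⟨ νℕ[p*m]≡1+νℕ[m] (p ^ v * u) (*-mono-≤ (m^n>0 p v) (p∤u⇒1≤u p∤u)) ⟩
    suc (νℕ p (p ^ v * u))  ≡⟨ cong suc (νℕ[p^v*u]≡v v u p∤u) ⟩
    suc v                   ∎
    where open ≡-Reasoning

  PowerFactorisation : ℕ → Set
  PowerFactorisation m = ∃₂ λ v u → ¬ (p ∣ u) × m ≡ p ^ v * u

  factorise : ∀ m → 1 ≤ m → PowerFactorisation m
  factorise = <-rec (λ m → 1 ≤ m → PowerFactorisation m) step
    where
    step : ∀ m → (∀ {k} → k < m → 1 ≤ k → PowerFactorisation k) → 1 ≤ m → PowerFactorisation m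
    step m rec 1≤m with p ∣? m
    ... | no p∤m = 0 , m , p∤m , sym (*-identityˡ m)
    ... | yes (divides k m≡kp) with rec k<m 1≤k
      where
      m≡pk : m ≡ p * k
      m≡pk = trans m≡kp (*-comm k p)
      1≤k : 1 ≤ k
      1≤k = n≢0⇒n>0 (λ k≡0 → <⇒≱ 1≤m (≤-reflexive (trans m≡kp (cong (_* p) k≡0))))
      k<m : k < m
      k<m = <-≤-trans (m<p*m 1≤k) (≤-reflexive (sym m≡pk))
    ... | v , u , p∤u , k≡p^v*u = suc v , u , p∤u , (begin
      m              ≡⟨ m≡kp ⟩
      k * p          ≡⟨ *-comm k p ⟩
      p * k          ≡⟨ cong (p *_) k≡p^v*u ⟩
      p * (p ^ v * u) ≡⟨ *-assoc p (p ^ v) u ⟨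
      p ^ suc v * u  ∎)
      where open ≡-Reasoning

  νℕ[m*n]≡νℕ[m]+νℕ[n] : Prime p → ∀ m n → 1 ≤ m → 1 ≤ n → νℕ p (m * n) ≡ νℕ p m + νℕ p n
  νℕ[m*n]≡νℕ[m]+νℕ[n] p-prime m n 1≤m 1≤n with factorise m 1≤m | factorise n 1≤n
  ... | v , u , p∤u , refl | w , t , p∤t , refl = begin
    νℕ p (p ^ v * u * (p ^ w * t))      ≡⟨ cong (νℕ p) (regroup (p ^ v) u (p ^ w) t) ⟩
    νℕ p (p ^ v * p ^ w * (u * t))      ≡⟨ cong (λ x → νℕ p (x * (u * t))) (^-distribˡ-+-* p v w) ⟨
    νℕ p (p ^ (v + w) * (u * t))        ≡⟨ νℕ[p^v*u]≡v (v + w) (u * t) p∤ut ⟩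
    v + w                               ≡⟨ cong₂ _+_ (νℕ[p^v*u]≡v v u p∤u) (νℕ[p^v*u]≡v w t p∤t) ⟨
    νℕ p (p ^ v * u) + νℕ p (p ^ w * t) ∎
    where
    open ≡-Reasoning
    regroup : ∀ a b c d → a * b * (c * d) ≡ a * c * (b * d)
    regroup = solve-∀
    p∤ut : ¬ (p ∣ u * t)
    p∤ut p∣ut = [ p∤u , p∤t ]′ (euclidsLemma u t p-prime p∣ut)

  p^νℕ[m]∣m : ∀ m → 1 ≤ m → p ^ νℕ p m ∣ m
  p^νℕ[m]∣m m 1≤m with factorise m 1≤m
  ... | v , u , p∤u , refl rewrite νℕ[p^v*u]≡v v u p∤u = m∣m*n u

  p^[1+e]∤m⇒νℕ[m]≤e : ∀ e {m} → 1 ≤ m → ¬ (p ^ suc e ∣ m) → νℕ p m ≤ e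
  p^[1+e]∤m⇒νℕ[m]≤e e {m} 1≤m p^[1+e]∤m with νℕ p m ≤? e
  ... | yes νℕ[m]≤e = νℕ[m]≤e
  ... | no  νℕ[m]≰e = ⊥-elim (p^[1+e]∤m (∣-trans (^-monoʳ-∣ p (≰⇒> νℕ[m]≰e)) (p^νℕ[m]∣m m 1≤m)))

  p∤m⇒νℕ[m]≡0 : ∀ {m} → ¬ (p ∣ m) → νℕ p m ≡ 0
  p∤m⇒νℕ[m]≡0 {m} p∤m = trans (cong (νℕ p) (sym (*-identityˡ m))) (νℕ[p^v*u]≡v 0 m p∤m)

module DigitSum (q : ℕ) where
  open import Data.Nat
  open import Data.Nat.Properties
  open import Data.Nat.Divisibility
  open import Data.Nat.DivMod
  open import Data.Nat.Induction using (<-rec)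
  open import Data.Nat.Tactic.RingSolver using (solve-∀)
  open import Data.Sum using (inj₁; inj₂)
  open import Relation.Nullary using (¬_)
  open import Relation.Binary.PropositionalEquality

  open Valuation q

  digitSumFuel : ℕ → ℕ → ℕ
  digitSumFuel zero    m = 0
  digitSumFuel (suc f) m = m % p + digitSumFuel f (m / p)

  digitSum : ℕ → ℕ
  digitSum m = digitSumFuel m m

  private
    [r+k*p]%p≡r : ∀ r k → r < p → (r + k * p) % p ≡ r
    [r+k*p]%p≡r r k r<p = trans ([m+kn]%n≡m%n r k p) (m<n⇒m%n≡m r<p)

    [r+k*p]/p≡k : ∀ r k → r < p → (r + k * p) / p ≡ k
    [r+k*p]/p≡k r k r<p = begin
      (r + k * p) / p    ≡⟨ +-distrib-/ r (k * p) (subst (_< p) (sym remainders) r<p) ⟩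
      r / p + k * p / p  ≡⟨ cong₂ _+_ (m<n⇒m/n≡0 r<p) (m*n/n≡m k p) ⟩
      k                  ∎
      where
      open ≡-Reasoning
      remainders : r % p + k * p % p ≡ r
      remainders = trans (cong₂ _+_ (m<n⇒m%n≡m r<p) (m*n%n≡0 k p)) (+-identityʳ r)

    digitSumFuel-0 : ∀ f → digitSumFuel f 0 ≡ 0
    digitSumFuel-0 zero    = refl
    digitSumFuel-0 (suc f) = digitSumFuel-0 f

    digitSumFuel-fuel : ∀ f g m → m ≤ f → m ≤ g → digitSumFuel f m ≡ digitSumFuel g m
    digitSumFuel-fuel f       g       zero    _   _   = trans (digitSumFuel-0 f) (sym (digitSumFuel-0 g))
    digitSumFuel-fuel (suc f) (suc g) (suc m) m≤f m≤g = cong (suc m % p +_)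
      (digitSumFuel-fuel f g (suc m / p) (<⇒≤pred (<-≤-trans ([1+m]/p<1+m m) m≤f)) (<⇒≤pred (<-≤-trans ([1+m]/p<1+m m) m≤g)))

  digitSum-unfold : ∀ m → digitSum m ≡ m % p + digitSum (m / p)
  digitSum-unfold zero    = refl
  digitSum-unfold (suc m) = cong (suc m % p +_)
    (digitSumFuel-fuel m (suc m / p) (suc m / p) (≤-pred ([1+m]/p<1+m m)) ≤-refl)

  digitSum[r+k*p]≡r+digitSum[k] : ∀ r k → r < p → digitSum (r + k * p) ≡ r + digitSum k
  digitSum[r+k*p]≡r+digitSum[k] r k r<p = trans (digitSum-unfold (r + k * p))
    (cong₂ _+_ ([r+k*p]%p≡r r k r<p) (cong digitSum ([r+k*p]/p≡k r k r<p)))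

  digitSum[r]≡r : ∀ r → r < p → digitSum r ≡ r
  digitSum[r]≡r r r<p = begin
    digitSum r           ≡⟨ cong digitSum (+-identityʳ r) ⟨
    digitSum (r + 0 * p) ≡⟨ digitSum[r+k*p]≡r+digitSum[k] r 0 r<p ⟩
    r + 0                ≡⟨ +-identityʳ r ⟩
    r                    ∎
    where open ≡-Reasoning

  private
    no-carry : ∀ r k → suc r < p →
      digitSum (suc r + k * p) + (p ∸ 1) * νℕ p (suc r + k * p) ≡ suc (digitSum (r + k * p))
    no-carry r k 1+r<p = begin
      digitSum (suc r + k * p) + (p ∸ 1) * νℕ p (suc r + k * p)
        ≡⟨ cong₂ (λ s v → s + (p ∸ 1) * v) (digitSum[r+k*p]≡r+digitSum[k] (suc r) k 1+r<p) (p∤m⇒νℕ[m]≡0 p∤m) ⟩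
      suc r + digitSum k + (p ∸ 1) * 0  ≡⟨ cong (suc r + digitSum k +_) (*-zeroʳ (p ∸ 1)) ⟩
      suc r + digitSum k + 0            ≡⟨ +-identityʳ _ ⟩
      suc (r + digitSum k)              ≡⟨ cong suc (digitSum[r+k*p]≡r+digitSum[k] r k (<-trans (n<1+n r) 1+r<p)) ⟨
      suc (digitSum (r + k * p))        ∎
      where
      open ≡-Reasoning
      p∤m : ¬ (p ∣ suc r + k * p)
      p∤m p∣m = 1+n≢0 (trans (sym ([r+k*p]%p≡r (suc r) k 1+r<p)) (n∣m⇒m%n≡0 _ p p∣m))

    carry : ∀ k → digitSum (suc k) + (p ∸ 1) * νℕ p (suc k) ≡ suc (digitSum k) →
      digitSum (suc k * p) + (p ∸ 1) * νℕ p (suc k * p) ≡ suc (digitSum ((p ∸ 1) + k * p))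
    carry k ih = begin
      digitSum (suc k * p) + (p ∸ 1) * νℕ p (suc k * p)
        ≡⟨ cong₂ (λ s v → s + (p ∸ 1) * v) (digitSum[r+k*p]≡r+digitSum[k] 0 (suc k) (s≤s z≤n)) νℕ[[1+k]*p] ⟩
      digitSum (suc k) + (p ∸ 1) * suc (νℕ p (suc k))          ≡⟨ shift (digitSum (suc k)) (p ∸ 1) (νℕ p (suc k)) ⟩
      (p ∸ 1) + (digitSum (suc k) + (p ∸ 1) * νℕ p (suc k))    ≡⟨ cong ((p ∸ 1) +_) ih ⟩
      (p ∸ 1) + suc (digitSum k)                               ≡⟨ +-suc (p ∸ 1) (digitSum k) ⟩
      suc ((p ∸ 1) + digitSum k)                               ≡⟨ cong suc (digitSum[r+k*p]≡r+digitSum[k] (p ∸ 1) k ≤-refl) ⟨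
      suc (digitSum ((p ∸ 1) + k * p))                         ∎
      where
      open ≡-Reasoning
      νℕ[[1+k]*p] : νℕ p (suc k * p) ≡ suc (νℕ p (suc k))
      νℕ[[1+k]*p] = trans (cong (νℕ p) (*-comm (suc k) p)) (νℕ[p*m]≡1+νℕ[m] (suc k) (s≤s z≤n))
      shift : ∀ s a v → s + a * suc v ≡ a + (s + a * v)
      shift = solve-∀

  -- Adding 1 to m turns its νℕ p (1 + m) trailing digits p - 1 into zeros.
  digitSum[1+m]+[p-1]νℕ[1+m]≡1+digitSum[m] : ∀ m →
    digitSum (suc m) + (p ∸ 1) * νℕ p (suc m) ≡ suc (digitSum m)
  digitSum[1+m]+[p-1]νℕ[1+m]≡1+digitSum[m] = <-rec _ step
    where
    step : ∀ m → (∀ {k} → k < m → digitSum (suc k) + (p ∸ 1) * νℕ p (suc k) ≡ suc (digitSum k)) →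
      digitSum (suc m) + (p ∸ 1) * νℕ p (suc m) ≡ suc (digitSum m)
    step m rec with m % p | m / p | m≡m%n+[m/n]*n m p | m%n<n m p
    ... | r | k | refl | r<p with m≤n⇒m<n∨m≡n r<p
    ... | inj₁ 1+r<p = no-carry r k 1+r<p
    ... | inj₂ refl  = carry k (rec (s≤s (≤-trans (m≤m*n k p) (m≤n+m (k * p) q))))

  legendre : Prime p → ∀ m → digitSum m + (p ∸ 1) * νℕ p (m !) ≡ m
  legendre p-prime zero    = *-zeroʳ (p ∸ 1)
  legendre p-prime (suc m) = begin
    digitSum (suc m) + (p ∸ 1) * νℕ p (suc m * m !)
      ≡⟨ cong (λ v → digitSum (suc m) + (p ∸ 1) * v) (νℕ[m*n]≡νℕ[m]+νℕ[n] p-prime (suc m) (m !) (s≤s z≤n) (1≤n! m)) ⟩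
    digitSum (suc m) + (p ∸ 1) * (νℕ p (suc m) + νℕ p (m !))
      ≡⟨ distrib (digitSum (suc m)) (p ∸ 1) (νℕ p (suc m)) (νℕ p (m !)) ⟩
    (digitSum (suc m) + (p ∸ 1) * νℕ p (suc m)) + (p ∸ 1) * νℕ p (m !)
      ≡⟨ cong (_+ (p ∸ 1) * νℕ p (m !)) (digitSum[1+m]+[p-1]νℕ[1+m]≡1+digitSum[m] m) ⟩
    suc (digitSum m + (p ∸ 1) * νℕ p (m !))  ≡⟨ cong suc (legendre p-prime m) ⟩
    suc m                                    ∎
    where
    open ≡-Reasoning
    distrib : ∀ s a u v → s + a * (u + v) ≡ (s + a * u) + a * v
    distrib = solve-∀

  private
    p^e≢0 : ∀ e → NonZero (p ^ e)
    p^e≢0 e = m^n≢0 p e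

    r/p<p^e : ∀ e r → r < p ^ suc e → r / p < p ^ e
    r/p<p^e e r r<p^[1+e] = m<n*o⇒m/o<n (≤-trans r<p^[1+e] (≤-reflexive (*-comm p (p ^ e))))

  digitSum[p^e*Q+r]≡digitSum[Q]+digitSum[r] : ∀ e Q r → r < p ^ e →
    digitSum (p ^ e * Q + r) ≡ digitSum Q + digitSum r
  digitSum[p^e*Q+r]≡digitSum[Q]+digitSum[r] zero Q zero _ = begin
    digitSum (1 * Q + 0) ≡⟨ cong digitSum (trans (+-identityʳ _) (*-identityˡ Q)) ⟩
    digitSum Q           ≡⟨ +-identityʳ (digitSum Q) ⟨
    digitSum Q + 0       ∎
    where open ≡-Reasoning
  digitSum[p^e*Q+r]≡digitSum[Q]+digitSum[r] zero Q (suc r) (s≤s ())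
  digitSum[p^e*Q+r]≡digitSum[Q]+digitSum[r] (suc e) Q r r<p^[1+e] = begin
    digitSum (p ^ suc e * Q + r)                 ≡⟨ cong (λ x → digitSum (p ^ suc e * Q + x)) (m≡m%n+[m/n]*n r p) ⟩
    digitSum (p ^ suc e * Q + (r % p + r / p * p)) ≡⟨ cong digitSum (regroup p (p ^ e) Q (r % p) (r / p)) ⟩
    digitSum (r % p + (p ^ e * Q + r / p) * p)   ≡⟨ digitSum[r+k*p]≡r+digitSum[k] (r % p) (p ^ e * Q + r / p) (m%n<n r p) ⟩
    r % p + digitSum (p ^ e * Q + r / p)         ≡⟨ cong (r % p +_) (digitSum[p^e*Q+r]≡digitSum[Q]+digitSum[r] e Q (r / p) (r/p<p^e e r r<p^[1+e])) ⟩
    r % p + (digitSum Q + digitSum (r / p))      ≡⟨ swap (r % p) (digitSum Q) (digitSum (r / p)) ⟩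
    digitSum Q + (r % p + digitSum (r / p))      ≡⟨ cong (digitSum Q +_) (digitSum-unfold r) ⟨
    digitSum Q + digitSum r                      ∎
    where
    open ≡-Reasoning
    swap : ∀ a b c → a + (b + c) ≡ b + (a + c)
    swap = solve-∀
    regroup : ∀ P A Q r₀ r₁ → P * A * Q + (r₀ + r₁ * P) ≡ r₀ + (A * Q + r₁) * P
    regroup = solve-∀

  digitSum[p^e*Q]≡digitSum[Q] : ∀ e Q → digitSum (p ^ e * Q) ≡ digitSum Q
  digitSum[p^e*Q]≡digitSum[Q] e Q = begin
    digitSum (p ^ e * Q)      ≡⟨ cong digitSum (+-identityʳ (p ^ e * Q)) ⟨
    digitSum (p ^ e * Q + 0)  ≡⟨ digitSum[p^e*Q+r]≡digitSum[Q]+digitSum[r] e Q 0 (m^n>0 p e) ⟩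
    digitSum Q + 0            ≡⟨ +-identityʳ (digitSum Q) ⟩
    digitSum Q                ∎
    where open ≡-Reasoning

  r≤p^e*digitSum[r] : ∀ e r → r < p ^ suc e → r ≤ p ^ e * digitSum r
  r≤p^e*digitSum[r] zero r r<p = begin
    r              ≡⟨ digitSum[r]≡r r (subst (r <_) (*-identityʳ p) r<p) ⟨
    digitSum r     ≡⟨ *-identityˡ (digitSum r) ⟨
    1 * digitSum r ∎
    where open ≤-Reasoning
  r≤p^e*digitSum[r] (suc e) r r<p^[2+e] = begin
    r                                               ≡⟨ m≡m%n+[m/n]*n r p ⟩
    r % p + r / p * p                               ≤⟨ +-mono-≤ (m≤n*m (r % p) (p ^ suc e) {{p^e≢0 (suc e)}}) r/p*p≤ ⟩
    p ^ suc e * (r % p) + p ^ suc e * digitSum (r / p) ≡⟨ *-distribˡ-+ (p ^ suc e) (r % p) (digitSum (r / p)) ⟨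
    p ^ suc e * (r % p + digitSum (r / p))          ≡⟨ cong (p ^ suc e *_) (digitSum-unfold r) ⟨
    p ^ suc e * digitSum r                          ∎
    where
    open ≤-Reasoning
    r/p*p≤ : r / p * p ≤ p ^ suc e * digitSum (r / p)
    r/p*p≤ = begin
      r / p * p                       ≤⟨ *-monoˡ-≤ p (r≤p^e*digitSum[r] e (r / p) (r/p<p^e (suc e) r r<p^[2+e])) ⟩
      p ^ e * digitSum (r / p) * p    ≡⟨ *-comm (p ^ e * digitSum (r / p)) p ⟩
      p * (p ^ e * digitSum (r / p))  ≡⟨ *-assoc p (p ^ e) (digitSum (r / p)) ⟨
      p ^ suc e * digitSum (r / p)    ∎

  digitSum[m+d]≤digitSum[m]+d : ∀ m d → digitSum (m + d) ≤ digitSum m + d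
  digitSum[m+d]≤digitSum[m]+d m zero = ≤-reflexive (trans (cong digitSum (+-identityʳ m)) (sym (+-identityʳ (digitSum m))))
  digitSum[m+d]≤digitSum[m]+d m (suc d) = begin
    digitSum (m + suc d)     ≡⟨ cong digitSum (+-suc m d) ⟩
    digitSum (suc (m + d))   ≤⟨ m≤m+n _ _ ⟩
    digitSum (suc (m + d)) + (p ∸ 1) * νℕ p (suc (m + d)) ≡⟨ digitSum[1+m]+[p-1]νℕ[1+m]≡1+digitSum[m] (m + d) ⟩
    suc (digitSum (m + d))   ≤⟨ s≤s (digitSum[m+d]≤digitSum[m]+d m d) ⟩
    suc (digitSum m + d)     ≡⟨ +-suc (digitSum m) d ⟨
    digitSum m + suc d       ∎
    where open ≤-Reasoning

  p^e*digitSum[K]+j≤p^e*digitSum[j]+K : ∀ e K j → p ^ suc e ∣ K → j < K + p ^ suc e →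
    p ^ e * digitSum K + j ≤ p ^ e * digitSum j + K
  p^e*digitSum[K]+j≤p^e*digitSum[j]+K e K j (divides Q K≡Q*M) j<K+M = begin
    A * digitSum K + j                        ≡⟨ cong₂ (λ x y → A * x + y) digitSum[K] j≡ ⟩
    A * digitSum Q + (r + Q′ * M)             ≤⟨ +-monoˡ-≤ (r + Q′ * M) (*-monoʳ-≤ A digitSum[Q]≤) ⟩
    A * (digitSum Q′ + d) + (r + Q′ * M)      ≡⟨ regroupˡ A (digitSum Q′) d r Q′ M ⟩
    (A * digitSum Q′ + Q′ * M) + (A * d + r)  ≤⟨ +-monoʳ-≤ (A * digitSum Q′ + Q′ * M) (+-mono-≤ A*d≤d*M r≤A*digitSum[r]) ⟩
    (A * digitSum Q′ + Q′ * M) + (d * M + A * digitSum r) ≡⟨ regroupʳ A (digitSum Q′) (digitSum r) d Q′ M ⟩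
    A * (digitSum Q′ + digitSum r) + (Q′ + d) * M ≡⟨ cong₂ (λ x y → A * x + y * M) digitSum[j] Q≡Q′+d ⟨
    A * digitSum j + Q * M                    ≡⟨ cong (A * digitSum j +_) K≡Q*M ⟨
    A * digitSum j + K                        ∎
    where
    open ≤-Reasoning
    A = p ^ e
    M = p ^ suc e
    instance
      M≢0 : NonZero M
      M≢0 = p^e≢0 (suc e)
    r  = j % M
    Q′ = j / M
    d  = Q ∸ Q′
    j≡ : j ≡ r + Q′ * M
    j≡ = m≡m%n+[m/n]*n j M
    r<M : r < M
    r<M = m%n<n j M
    Q′≤Q : Q′ ≤ Q
    Q′≤Q = ≤-pred (m<n*o⇒m/o<n (≤-trans j<K+M (≤-reflexive (trans (cong (_+ M) K≡Q*M) (+-comm (Q * M) M)))))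
    Q≡Q′+d : Q ≡ Q′ + d
    Q≡Q′+d = sym (m+[n∸m]≡n Q′≤Q)
    digitSum[K] : digitSum K ≡ digitSum Q
    digitSum[K] = trans (cong digitSum (trans K≡Q*M (*-comm Q M))) (digitSum[p^e*Q]≡digitSum[Q] (suc e) Q)
    digitSum[j] : digitSum j ≡ digitSum Q′ + digitSum r
    digitSum[j] = trans (cong digitSum (trans j≡ (trans (+-comm r (Q′ * M)) (cong (_+ r) (*-comm Q′ M)))))
                        (digitSum[p^e*Q+r]≡digitSum[Q]+digitSum[r] (suc e) Q′ r r<M)
    digitSum[Q]≤ : digitSum Q ≤ digitSum Q′ + d
    digitSum[Q]≤ = subst (λ x → digitSum x ≤ digitSum Q′ + d) (sym Q≡Q′+d) (digitSum[m+d]≤digitSum[m]+d Q′ d)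
    A*d≤d*M : A * d ≤ d * M
    A*d≤d*M = ≤-trans (≤-reflexive (*-comm A d)) (*-monoʳ-≤ d (m≤n*m A p))
    r≤A*digitSum[r] : r ≤ A * digitSum r
    r≤A*digitSum[r] = r≤p^e*digitSum[r] e r r<M
    regroupˡ : ∀ A s d r Q′ M → A * (s + d) + (r + Q′ * M) ≡ (A * s + Q′ * M) + (A * d + r)
    regroupˡ = solve-∀
    regroupʳ : ∀ A s t d Q′ M → (A * s + Q′ * M) + (d * M + A * t) ≡ A * (s + t) + (Q′ + d) * M
    regroupʳ = solve-∀

  digitSum[K+b*p^e]≡digitSum[K]+b : ∀ e K b → p ^ suc e ∣ K → b < p →
    digitSum (K + b * p ^ e) ≡ digitSum K + b
  digitSum[K+b*p^e]≡digitSum[K]+b e K b (divides Q refl) b<p = begin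
    digitSum (Q * p ^ suc e + b * p ^ e)  ≡⟨ cong digitSum (regroup p (p ^ e) Q b) ⟩
    digitSum (p ^ e * (b + Q * p))        ≡⟨ digitSum[p^e*Q]≡digitSum[Q] e (b + Q * p) ⟩
    digitSum (b + Q * p)                  ≡⟨ digitSum[r+k*p]≡r+digitSum[k] b Q b<p ⟩
    b + digitSum Q                        ≡⟨ +-comm b (digitSum Q) ⟩
    digitSum Q + b                        ≡⟨ cong (_+ b) (digitSum[p^e*Q]≡digitSum[Q] (suc e) Q) ⟨
    digitSum (p ^ suc e * Q) + b          ≡⟨ cong (λ x → digitSum x + b) (*-comm (p ^ suc e) Q) ⟩
    digitSum (Q * p ^ suc e) + b          ∎
    where
    open ≡-Reasoning
    regroup : ∀ P A Q b → Q * (P * A) + b * A ≡ A * (b + Q * P)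
    regroup = solve-∀

module Expansion (q : ℕ) where
  open import Data.Nat
  open import Data.Nat.Properties
  open import Data.Nat.Divisibility
  open import Data.Nat.DivMod
  open import Data.List using (List; []; _∷_; take; length)
  open import Data.List.Properties using (take-all)
  open import Data.List.Relation.Unary.All as All using (All; []; _∷_)
  open import Data.List.Relation.Unary.Linked as Linked using (Linked; []; [-]; _∷_)
  open import Data.List.Relation.Unary.Linked.Properties using (Linked⇒All)
  open import Data.Product using (Σ; _×_; _,_; proj₁; proj₂)
  open import Relation.Nullary using (¬_)
  open import Relation.Binary.PropositionalEquality

  open Valuation q

  IsDigit : ℕ × ℕ → Set
  IsDigit be = (0 < proj₁ be) × (proj₁ be < p)

  Decreasing : ℕ × ℕ → ℕ × ℕ → Set
  Decreasing be be′ = proj₂ be′ < proj₂ be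

  ExponentBelow : ℕ → ℕ × ℕ → Set
  ExponentBelow E be = proj₂ be < E

  -- the i-th pair (digit , exponent), with junk (0 , 0) past the end
  term : List (ℕ × ℕ) → ℕ → ℕ × ℕ
  term []       _       = 0 , 0
  term (t ∷ ts) zero    = t
  term (t ∷ ts) (suc i) = term ts i

  pivot : List (ℕ × ℕ) → ℕ → ℕ
  pivot bs i = repValue p (take i bs)

  private
    exponents-below-head : ∀ {t ts} → Linked Decreasing (t ∷ ts) → All (ExponentBelow (proj₂ t)) ts
    exponents-below-head [-]         = []
    exponents-below-head {t} (e′<e ∷ ds) = Linked⇒All {R = Decreasing} (λ e″<e′ e′<e → <-trans e′<e e″<e′) {v = t} e′<e ds

  repValue<p^E : ∀ E {bs} → All IsDigit bs → Linked Decreasing bs → All (ExponentBelow E) bs →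
    repValue p bs < p ^ E
  repValue<p^E E {[]} _ _ _ = m^n>0 p E
  repValue<p^E E {(b , e) ∷ bs} ((_ , b<p) ∷ digits) dec (e<E ∷ _) = begin-strict
    b * p ^ e + repValue p bs  <⟨ +-monoʳ-< (b * p ^ e) (repValue<p^E e digits (Linked.tail dec) (exponents-below-head dec)) ⟩
    b * p ^ e + p ^ e          ≡⟨ +-comm (b * p ^ e) (p ^ e) ⟩
    suc b * p ^ e              ≤⟨ *-monoˡ-≤ (p ^ e) b<p ⟩
    p ^ suc e                  ≤⟨ ^-monoʳ-≤ p e<E ⟩
    p ^ E                      ∎
    where open ≤-Reasoning

  digit exponent : List (ℕ × ℕ) → ℕ → ℕ
  digit    bs i = proj₁ (term bs i)
  exponent bs i = proj₂ (term bs i)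

  All-term : ∀ {P : ℕ × ℕ → Set} {bs i} → All P bs → i < length bs → P (term bs i)
  All-term {i = zero}  (px ∷ _)  _         = px
  All-term {i = suc i} (_ ∷ pxs) (s≤s i<s) = All-term pxs i<s

  record PivotStep (bs : List (ℕ × ℕ)) (i : ℕ) : Set where
    field
      isDigit         : IsDigit (term bs i)
      pivot-suc       : pivot bs (suc i) ≡ pivot bs i + digit bs i * p ^ exponent bs i
      p^[1+e]∣pivot   : p ^ suc (exponent bs i) ∣ pivot bs i
      value<pivot+p^e : repValue p bs < pivot bs (suc i) + p ^ exponent bs i

  pivotStep : ∀ {bs} i → All IsDigit bs → Linked Decreasing bs → i < length bs → PivotStep bs i
  pivotStep {(b , e) ∷ bs} zero (isDigit ∷ digits) dec _ = record
    { isDigit         = isDigit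
    ; pivot-suc       = +-identityʳ (b * p ^ e)
    ; p^[1+e]∣pivot   = (p ^ suc e) ∣0
    ; value<pivot+p^e = begin-strict
        b * p ^ e + repValue p bs   <⟨ +-monoʳ-< (b * p ^ e) (repValue<p^E e digits (Linked.tail dec) (exponents-below-head dec)) ⟩
        b * p ^ e + p ^ e           ≡⟨ cong (_+ p ^ e) (+-identityʳ (b * p ^ e)) ⟨
        b * p ^ e + 0 + p ^ e       ∎
    }
    where open ≤-Reasoning
  pivotStep {(b , e) ∷ bs} (suc i) (_ ∷ digits) dec (s≤s i<s) = record
    { isDigit         = isDigit
    ; pivot-suc       = trans (cong (b * p ^ e +_) pivot-suc) (sym (+-assoc (b * p ^ e) _ _))
    ; p^[1+e]∣pivot   = ∣m∣n⇒∣m+n (∣n⇒∣m*n b (^-monoʳ-∣ p (All-term (exponents-below-head dec) i<s))) p^[1+e]∣pivot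
    ; value<pivot+p^e = ≤-trans (+-monoʳ-< (b * p ^ e) value<pivot+p^e) (≤-reflexive (sym (+-assoc (b * p ^ e) _ _)))
    }
    where open PivotStep (pivotStep i digits (Linked.tail dec) i<s)

  exponent-decreasing : ∀ {bs} i → Linked Decreasing bs → suc i < length bs →
    exponent bs (suc i) < exponent bs i
  exponent-decreasing {_ ∷ _ ∷ _} zero    (e′<e ∷ _) _         = e′<e
  exponent-decreasing {_ ∷ _ ∷ _} (suc i) (_ ∷ dec)  (s≤s i<s) = exponent-decreasing i dec i<s
  exponent-decreasing {_ ∷ []}    _       [-]        (s≤s ())

  pivot-length : ∀ bs → pivot bs (length bs) ≡ repValue p bs
  pivot-length bs = cong (repValue p) (take-all (length bs) bs ≤-refl)

  private
    n<p^n : ∀ n → n < p ^ n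
    n<p^n zero    = s≤s z≤n
    n<p^n (suc n) = begin-strict
      suc n                <⟨ s≤s (n<p^n n) ⟩
      1 + p ^ n            ≤⟨ +-monoˡ-≤ (p ^ n) (m^n>0 p n) ⟩
      p ^ n + p ^ n        ≤⟨ +-monoʳ-≤ (p ^ n) (m≤m+n (p ^ n) (q * p ^ n)) ⟩
      p ^ suc n            ∎
      where open ≤-Reasoning

    ExpansionBelow : ℕ → ℕ → Set
    ExpansionBelow E n = Σ (List (ℕ × ℕ)) λ bs →
      All IsDigit bs × Linked Decreasing bs × All (ExponentBelow E) bs × repValue p bs ≡ n

    expansionBelow : ∀ E n → n < p ^ E → ExpansionBelow E n
    expansionBelow zero    zero    _ = [] , [] , [] , [] , refl
    expansionBelow zero    (suc n) (s≤s ())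
    expansionBelow (suc E) n n<p^[1+E] = go {{m^n≢0 p E}}
      where
      raise : ∀ {bs} → All (ExponentBelow E) bs → All (ExponentBelow (suc E)) bs
      raise = All.map (λ e<E → <-trans e<E (n<1+n E))
      cons : ∀ {b bs} → All (ExponentBelow E) bs → Linked Decreasing bs → Linked Decreasing ((b , E) ∷ bs)
      cons []         _   = [-]
      cons (e<E ∷ _)  dec = e<E ∷ dec
      go : {{_ : NonZero (p ^ E)}} → ExpansionBelow (suc E) n
      go with expansionBelow E (n % p ^ E) (m%n<n n (p ^ E)) | n / p ^ E | m≡m%n+[m/n]*n n (p ^ E) | m<n*o⇒m/o<n {n} {p} {p ^ E} n<p^[1+E]
      ... | bs , digits , dec , below , value | zero | n≡ | _ =
        bs , digits , dec , raise below , trans value (trans (sym (+-identityʳ _)) (sym n≡))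
      ... | bs , digits , dec , below , value | suc b | n≡ | b<p =
        (suc b , E) ∷ bs , (s≤s z≤n , b<p) ∷ digits , cons below dec , n<1+n E ∷ raise below ,
        trans (cong (suc b * p ^ E +_) value) (trans (+-comm _ (n % p ^ E)) (sym n≡))

  expansion : ∀ n → Σ (List (ℕ × ℕ)) (IsBaseRep n p)
  expansion n with expansionBelow n n (n<p^n n)
  ... | bs , digits , dec , _ , value = bs , digits , dec , value

  pivot≤repValue : ∀ bs i → pivot bs i ≤ repValue p bs
  pivot≤repValue []                zero    = z≤n
  pivot≤repValue []                (suc i) = z≤n
  pivot≤repValue ((b , e) ∷ bs)    zero    = z≤n
  pivot≤repValue ((b , e) ∷ bs)    (suc i) = +-monoʳ-≤ (b * p ^ e) (pivot≤repValue bs i)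

  module Pivots {n bs} (isExpansion : IsBaseRep n p bs) where

    private
      digits = proj₁ isExpansion
      dec    = proj₁ (proj₂ isExpansion)
      value  = proj₂ (proj₂ isExpansion)

    s : ℕ
    s = length bs

    k : ℕ → ℕ
    k = pivot bs

    e : ℕ → ℕ
    e = exponent bs

    k[s]≡n : k s ≡ n
    k[s]≡n = trans (pivot-length bs) value

    step : ∀ i → i < s → PivotStep bs i
    step i i<s = pivotStep i digits dec i<s

    k<k[1+i] : ∀ i → i < s → k i < k (suc i)
    k<k[1+i] i i<s = <-≤-trans (m<m+n (k i) (*-mono-≤ (proj₁ isDigit) (m^n>0 p (e i)))) (≤-reflexive (sym pivot-suc))
      where open PivotStep (step i i<s)

    exponent-< : ∀ i → suc i < s → e (suc i) < e i
    exponent-< i 1+i<s = exponent-decreasing i dec 1+i<s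

    n<k+p^[1+e] : ∀ i → i < s → n < k i + p ^ suc (e i)
    n<k+p^[1+e] i i<s = begin-strict
      n                                ≡⟨ value ⟨
      repValue p bs                    <⟨ value<pivot+p^e ⟩
      k (suc i) + p ^ e i              ≡⟨ cong (_+ p ^ e i) pivot-suc ⟩
      k i + digit bs i * p ^ e i + p ^ e i   ≡⟨ +-assoc (k i) _ _ ⟩
      k i + (digit bs i * p ^ e i + p ^ e i) ≡⟨ cong (k i +_) (+-comm (digit bs i * p ^ e i) (p ^ e i)) ⟩
      k i + suc (digit bs i) * p ^ e i ≤⟨ +-monoʳ-≤ (k i) (*-monoˡ-≤ (p ^ e i) (proj₂ isDigit)) ⟩
      k i + p ^ suc (e i)              ∎
      where
      open ≤-Reasoning
      open PivotStep (step i i<s)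

    νℕ[n]≤e : ∀ i → i < s → νℕ p n ≤ e i
    νℕ[n]≤e i i<s = p^[1+e]∤m⇒νℕ[m]≤e (e i) 1≤n p^[1+e]∤n
      where
      open PivotStep (step i i<s)
      b    = digit bs i
      rest = n ∸ k (suc i)
      V    = b * p ^ e i + rest
      k[1+i]≤n : k (suc i) ≤ n
      k[1+i]≤n = subst (k (suc i) ≤_) value (pivot≤repValue bs (suc i))
      n≡k+V : n ≡ k i + V
      n≡k+V = begin
        n                      ≡⟨ m+[n∸m]≡n k[1+i]≤n ⟨
        k (suc i) + rest       ≡⟨ cong (_+ rest) pivot-suc ⟩
        k i + b * p ^ e i + rest ≡⟨ +-assoc (k i) (b * p ^ e i) rest ⟩
        k i + V                ∎
        where open ≡-Reasoning
      rest<p^e : rest < p ^ e i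
      rest<p^e = +-cancelˡ-< (k (suc i)) rest (p ^ e i)
        (subst (_< k (suc i) + p ^ e i) (sym (m+[n∸m]≡n k[1+i]≤n)) (subst (_< k (suc i) + p ^ e i) value value<pivot+p^e))
      1≤V : 1 ≤ V
      1≤V = ≤-trans (*-mono-≤ (proj₁ isDigit) (m^n>0 p (e i))) (m≤m+n (b * p ^ e i) rest)
      1≤n : 1 ≤ n
      1≤n = ≤-trans 1≤V (≤-trans (m≤n+m V (k i)) (≤-reflexive (sym n≡k+V)))
      V<p^[1+e] : V < p ^ suc (e i)
      V<p^[1+e] = begin-strict
        b * p ^ e i + rest       <⟨ +-monoʳ-< (b * p ^ e i) rest<p^e ⟩
        b * p ^ e i + p ^ e i    ≡⟨ +-comm (b * p ^ e i) (p ^ e i) ⟩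
        suc b * p ^ e i          ≤⟨ *-monoˡ-≤ (p ^ e i) (proj₂ isDigit) ⟩
        p ^ suc (e i)            ∎
        where open ≤-Reasoning
      p^[1+e]∤n : ¬ (p ^ suc (e i) ∣ n)
      p^[1+e]∤n p^[1+e]∣n = <⇒≱ V<p^[1+e] (∣⇒≤ {{>-nonZero 1≤V}} (∣m+n∣m⇒∣n (subst (p ^ suc (e i) ∣_) n≡k+V p^[1+e]∣n) p^[1+e]∣pivot))

module Embedding where
  import Data.Nat as ℕ
  import Data.Nat.Properties as ℕ
  open import Data.Nat.Coprimality using (1-coprimeTo)
  import Data.Nat.Coprimality as Coprime
  open import Data.Integer as ℤ using (ℤ; +_)
  import Data.Integer.Properties as ℤ
  open import Data.Integer.Tactic.RingSolver using (solve-∀)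
  open import Data.Rational as ℚ using (mkℚ; 0ℚ; 1ℚ; _+_; _*_; -_; _-_; _≤_; _<_; toℚᵘ; ↥_; ↧_; ↧ₙ_)
  import Data.Rational.Properties as ℚ
  import Data.Rational.Unnormalised as ℚᵘ
  import Data.Rational.Unnormalised.Properties as ℚᵘ
  open import Relation.Binary.PropositionalEquality

  ℤ→ℚ≡mkℚ : ∀ z → ℤ→ℚ z ≡ mkℚ z 0 (Coprime.sym (1-coprimeTo ℤ.∣ z ∣))
  ℤ→ℚ≡mkℚ z = ℚ.↥p/↧p≡p (mkℚ z 0 (Coprime.sym (1-coprimeTo ℤ.∣ z ∣)))

  toℚᵘ-ℤ→ℚ : ∀ z → toℚᵘ (ℤ→ℚ z) ℚᵘ.≃ ℚᵘ.mkℚᵘ z 0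
  toℚᵘ-ℤ→ℚ z = ℚᵘ.≃-reflexive (cong toℚᵘ (ℤ→ℚ≡mkℚ z))

  ℤ→ℚ-homo-+ : ∀ a b → ℤ→ℚ (a ℤ.+ b) ≡ ℤ→ℚ a + ℤ→ℚ b
  ℤ→ℚ-homo-+ a b = ℚ.toℚᵘ-injective (begin
    toℚᵘ (ℤ→ℚ (a ℤ.+ b))                    ≈⟨ toℚᵘ-ℤ→ℚ (a ℤ.+ b) ⟩
    ℚᵘ.mkℚᵘ (a ℤ.+ b) 0                     ≈⟨ ℚᵘ.*≡* (solve a b) ⟩
    ℚᵘ.mkℚᵘ a 0 ℚᵘ.+ ℚᵘ.mkℚᵘ b 0            ≈⟨ ℚᵘ.+-cong (toℚᵘ-ℤ→ℚ a) (toℚᵘ-ℤ→ℚ b) ⟨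
    toℚᵘ (ℤ→ℚ a) ℚᵘ.+ toℚᵘ (ℤ→ℚ b)          ≈⟨ ℚ.toℚᵘ-homo-+ (ℤ→ℚ a) (ℤ→ℚ b) ⟨
    toℚᵘ (ℤ→ℚ a + ℤ→ℚ b)                    ∎)
    where
    open ℚᵘ.≃-Reasoning
    solve : ∀ a b → (a ℤ.+ b) ℤ.* + 1 ≡ (a ℤ.* + 1 ℤ.+ b ℤ.* + 1) ℤ.* + 1
    solve = solve-∀

  ℤ→ℚ-homo-* : ∀ a b → ℤ→ℚ (a ℤ.* b) ≡ ℤ→ℚ a * ℤ→ℚ b
  ℤ→ℚ-homo-* a b = ℚ.toℚᵘ-injective (begin
    toℚᵘ (ℤ→ℚ (a ℤ.* b))                    ≈⟨ toℚᵘ-ℤ→ℚ (a ℤ.* b) ⟩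
    ℚᵘ.mkℚᵘ (a ℤ.* b) 0                     ≈⟨ ℚᵘ.*≡* refl ⟩
    ℚᵘ.mkℚᵘ a 0 ℚᵘ.* ℚᵘ.mkℚᵘ b 0            ≈⟨ ℚᵘ.*-cong (toℚᵘ-ℤ→ℚ a) (toℚᵘ-ℤ→ℚ b) ⟨
    toℚᵘ (ℤ→ℚ a) ℚᵘ.* toℚᵘ (ℤ→ℚ b)          ≈⟨ ℚ.toℚᵘ-homo-* (ℤ→ℚ a) (ℤ→ℚ b) ⟨
    toℚᵘ (ℤ→ℚ a * ℤ→ℚ b)                    ∎)
    where open ℚᵘ.≃-Reasoning

  ℤ→ℚ-homo‿- : ∀ a → ℤ→ℚ (ℤ.- a) ≡ - ℤ→ℚ a
  ℤ→ℚ-homo‿- a = ℚ.toℚᵘ-injective (begin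
    toℚᵘ (ℤ→ℚ (ℤ.- a))       ≈⟨ toℚᵘ-ℤ→ℚ (ℤ.- a) ⟩
    ℚᵘ.mkℚᵘ (ℤ.- a) 0        ≈⟨ ℚᵘ.-‿cong (toℚᵘ-ℤ→ℚ a) ⟨
    ℚᵘ.- toℚᵘ (ℤ→ℚ a)        ≈⟨ ℚ.toℚᵘ-homo‿- (ℤ→ℚ a) ⟨
    toℚᵘ (- ℤ→ℚ a)           ∎)
    where open ℚᵘ.≃-Reasoning

  ℤ→ℚ-mono-≤ : ∀ {a b} → a ℤ.≤ b → ℤ→ℚ a ≤ ℤ→ℚ b
  ℤ→ℚ-mono-≤ {a} {b} a≤b rewrite ℤ→ℚ≡mkℚ a | ℤ→ℚ≡mkℚ b = ℚ.*≤* (ℤ.*-monoʳ-≤-nonNeg (+ 1) a≤b)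

  ℤ→ℚ-mono-< : ∀ {a b} → a ℤ.< b → ℤ→ℚ a < ℤ→ℚ b
  ℤ→ℚ-mono-< {a} {b} a<b rewrite ℤ→ℚ≡mkℚ a | ℤ→ℚ≡mkℚ b = ℚ.*<* (ℤ.*-monoʳ-<-pos (+ 1) a<b)

  ℕ→ℚ-homo-+ : ∀ m n → ℕ→ℚ (m ℕ.+ n) ≡ ℕ→ℚ m + ℕ→ℚ n
  ℕ→ℚ-homo-+ m n = trans (cong ℤ→ℚ (ℤ.pos-+ m n)) (ℤ→ℚ-homo-+ (+ m) (+ n))

  ℕ→ℚ-homo-* : ∀ m n → ℕ→ℚ (m ℕ.* n) ≡ ℕ→ℚ m * ℕ→ℚ n
  ℕ→ℚ-homo-* m n = trans (cong ℤ→ℚ (ℤ.pos-* m n)) (ℤ→ℚ-homo-* (+ m) (+ n))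

  ℕ→ℚ-mono-≤ : ∀ {m n} → m ℕ.≤ n → ℕ→ℚ m ≤ ℕ→ℚ n
  ℕ→ℚ-mono-≤ m≤n = ℤ→ℚ-mono-≤ (ℤ.+≤+ m≤n)

  ℕ→ℚ-mono-< : ∀ {m n} → m ℕ.< n → ℕ→ℚ m < ℕ→ℚ n
  ℕ→ℚ-mono-< m<n = ℤ→ℚ-mono-< (ℤ.+<+ m<n)

  ℕ→ℚ[0]≡0 : ℕ→ℚ 0 ≡ 0ℚ
  ℕ→ℚ[0]≡0 = ℚ.↥p/↧p≡p 0ℚ

  ℕ→ℚ[1]≡1 : ℕ→ℚ 1 ≡ 1ℚ
  ℕ→ℚ[1]≡1 = ℚ.↥p/↧p≡p 1ℚ

  0≤ℕ→ℚ : ∀ m → 0ℚ ≤ ℕ→ℚ m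
  0≤ℕ→ℚ m = subst (_≤ ℕ→ℚ m) ℕ→ℚ[0]≡0 (ℕ→ℚ-mono-≤ {0} {m} ℕ.z≤n)

  0<ℕ→ℚ : ∀ {m} → 0 ℕ.< m → 0ℚ < ℕ→ℚ m
  0<ℕ→ℚ {m} 0<m = subst (_< ℕ→ℚ m) ℕ→ℚ[0]≡0 (ℕ→ℚ-mono-< {0} {m} 0<m)

  ℤ→ℚ[+m-+n]≡ℕ→ℚ[m]-ℕ→ℚ[n] : ∀ m n → ℤ→ℚ ((+ m) ℤ.- (+ n)) ≡ ℕ→ℚ m - ℕ→ℚ n
  ℤ→ℚ[+m-+n]≡ℕ→ℚ[m]-ℕ→ℚ[n] m n = trans (ℤ→ℚ-homo-+ (+ m) (ℤ.- (+ n))) (cong (λ x → ℕ→ℚ m + x) (ℤ→ℚ-homo‿- (+ n)))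

  x*d≡z⇒↥x*d≡z*↧x : ∀ x {z d} → x * ℕ→ℚ d ≡ ℤ→ℚ z → ↥ x ℤ.* + d ≡ z ℤ.* ↧ x
  x*d≡z⇒↥x*d≡z*↧x x@(mkℚ _ _ _) {z} {d} x*d≡z = begin
    ↥ x ℤ.* + d              ≡⟨ ℤ.*-identityʳ _ ⟨
    ↥ x ℤ.* + d ℤ.* + 1      ≡⟨ ℚᵘ.drop-*≡* cross ⟩
    z ℤ.* + (↧ₙ x ℕ.* 1)     ≡⟨ cong (λ m → z ℤ.* + m) (ℕ.*-identityʳ (↧ₙ x)) ⟩
    z ℤ.* ↧ x                ∎
    where
    open ≡-Reasoning
    cross : toℚᵘ x ℚᵘ.* ℚᵘ.mkℚᵘ (+ d) 0 ℚᵘ.≃ ℚᵘ.mkℚᵘ z 0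
    cross = ℚᵘ.≃-trans (ℚᵘ.≃-sym (ℚᵘ.≃-trans (ℚ.toℚᵘ-homo-* x (ℕ→ℚ d)) (ℚᵘ.*-congˡ {toℚᵘ x} (toℚᵘ-ℤ→ℚ (+ d)))))
              (ℚᵘ.≃-trans (ℚ.toℚᵘ-cong x*d≡z) (toℚᵘ-ℤ→ℚ z))

module RationalValuation (q : ℕ) (p-prime : Prime (suc (suc q))) where
  open import Data.Nat as ℕ using (zero)
  import Data.Nat.Properties as ℕ
  open import Data.Integer as ℤ using (ℤ; +_)
  open import Data.Integer.GCD using (gcd)
  import Data.Integer.Properties as ℤ
  open import Data.Integer.Tactic.RingSolver using (solve-∀)
  open import Data.Rational as ℚ using (mkℚ; 0ℚ; _*_; ↥_; ↧_; ↧ₙ_)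
  import Data.Rational.Properties as ℚ
  open import Data.Sum using ([_,_]′)
  open import Data.Empty using (⊥-elim)
  open import Function using (_∘_)
  open import Relation.Binary.PropositionalEquality
  open Embedding
  open Valuation q

  *-≢0 : ∀ {x y} → x ≢ 0ℚ → y ≢ 0ℚ → x * y ≢ 0ℚ
  *-≢0 {x} {y} x≢0 y≢0 xy≡0 =
    [ x≢0 ∘ ℚ.↥p≡0⇒p≡0 x , y≢0 ∘ ℚ.↥p≡0⇒p≡0 y ]′ (ℤ.i*j≡0⇒i≡0∨j≡0 (↥ x) ↥x*↥y≡0)
    where
    ↥x*↥y≡0 : ↥ x ℤ.* ↥ y ≡ + 0
    ↥x*↥y≡0 = trans (sym (ℚ.↥-* x y)) (cong (λ z → ↥ z ℤ.* gcd (↥ x ℤ.* ↥ y) (↧ x ℤ.* ↧ y)) xy≡0)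

  private
    1≤↧ₙ : ∀ x → 1 ℕ.≤ ↧ₙ x
    1≤↧ₙ (mkℚ _ _ _) = ℕ.s≤s ℕ.z≤n

    1≤∣↥∣ : ∀ x → x ≢ 0ℚ → 1 ℕ.≤ ℤ.∣ ↥ x ∣
    1≤∣↥∣ x x≢0 = ℕ.n≢0⇒n>0 (λ ∣↥x∣≡0 → x≢0 (ℚ.↥p≡0⇒p≡0 x (ℤ.∣i∣≡0⇒i≡0 ∣↥x∣≡0)))

    1≤m*n⇒1≤n : ∀ m {n} → 1 ℕ.≤ m ℕ.* n → 1 ℕ.≤ n
    1≤m*n⇒1≤n m {zero}  1≤m*0 = ⊥-elim (ℕ.<⇒≱ 1≤m*0 (ℕ.≤-reflexive (ℕ.*-zeroʳ m)))
    1≤m*n⇒1≤n m {suc n} _     = ℕ.s≤s ℕ.z≤n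

  ordℚ-fraction : ∀ x {g n d} → ℤ.∣ ↥ x ∣ ℕ.* g ≡ n → ↧ₙ x ℕ.* g ≡ d → 1 ℕ.≤ n →
    ordℚ p x ≡ + νℕ p n ℤ.- + νℕ p d
  ordℚ-fraction x {g} refl refl 1≤n = begin
    + A ℤ.- + D                          ≡⟨ cancel (+ A) (+ D) (+ G) ⟩
    (+ A ℤ.+ + G) ℤ.- (+ D ℤ.+ + G)      ≡⟨ cong₂ ℤ._-_ (ℤ.pos-+ A G) (ℤ.pos-+ D G) ⟨
    + (A ℕ.+ G) ℤ.- + (D ℕ.+ G)          ≡⟨ cong₂ (λ a d → + a ℤ.- + d)
                                              (νℕ[m*n]≡νℕ[m]+νℕ[n] p-prime _ g 1≤∣↥x∣ 1≤g)
                                              (νℕ[m*n]≡νℕ[m]+νℕ[n] p-prime _ g (1≤↧ₙ x) 1≤g) ⟨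
    + νℕ p (ℤ.∣ ↥ x ∣ ℕ.* g) ℤ.- + νℕ p (↧ₙ x ℕ.* g) ∎
    where
    open ≡-Reasoning
    A = νℕ p ℤ.∣ ↥ x ∣
    D = νℕ p (↧ₙ x)
    G = νℕ p g
    1≤g : 1 ℕ.≤ g
    1≤g = 1≤m*n⇒1≤n ℤ.∣ ↥ x ∣ 1≤n
    1≤∣↥x∣ : 1 ℕ.≤ ℤ.∣ ↥ x ∣
    1≤∣↥x∣ = 1≤m*n⇒1≤n g (subst (1 ℕ.≤_) (ℕ.*-comm ℤ.∣ ↥ x ∣ g) 1≤n)
    cancel : ∀ a d g → a ℤ.- d ≡ (a ℤ.+ g) ℤ.- (d ℤ.+ g)
    cancel = solve-∀

  ordℚ-* : ∀ {x y} → x ≢ 0ℚ → y ≢ 0ℚ → ordℚ p (x * y) ≡ ordℚ p x ℤ.+ ordℚ p y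
  ordℚ-* {x} {y} x≢0 y≢0 = begin
    ordℚ p (x * y)                                    ≡⟨ ordℚ-fraction (x * y) numerator denominator 1≤∣↥x↥y∣ ⟩
    + νℕ p (∣↥x∣ ℕ.* ∣↥y∣) ℤ.- + νℕ p (↧ₙ x ℕ.* ↧ₙ y)  ≡⟨ cong₂ (λ a d → + a ℤ.- + d)
                                                           (νℕ[m*n]≡νℕ[m]+νℕ[n] p-prime ∣↥x∣ ∣↥y∣ (1≤∣↥∣ x x≢0) (1≤∣↥∣ y y≢0))
                                                           (νℕ[m*n]≡νℕ[m]+νℕ[n] p-prime (↧ₙ x) (↧ₙ y) (1≤↧ₙ x) (1≤↧ₙ y)) ⟩
    + (A ℕ.+ B) ℤ.- + (C ℕ.+ D)                        ≡⟨ cong₂ ℤ._-_ (ℤ.pos-+ A B) (ℤ.pos-+ C D) ⟩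
    (+ A ℤ.+ + B) ℤ.- (+ C ℤ.+ + D)                    ≡⟨ regroup (+ A) (+ B) (+ C) (+ D) ⟩
    (+ A ℤ.- + C) ℤ.+ (+ B ℤ.- + D)                    ∎
    where
    open ≡-Reasoning
    ∣↥x∣ = ℤ.∣ ↥ x ∣
    ∣↥y∣ = ℤ.∣ ↥ y ∣
    A = νℕ p ∣↥x∣
    B = νℕ p ∣↥y∣
    C = νℕ p (↧ₙ x)
    D = νℕ p (↧ₙ y)
    g = gcd (↥ x ℤ.* ↥ y) (↧ x ℤ.* ↧ y)
    numerator : ℤ.∣ ↥ (x * y) ∣ ℕ.* ℤ.∣ g ∣ ≡ ∣↥x∣ ℕ.* ∣↥y∣
    numerator = trans (sym (ℤ.abs-* (↥ (x * y)) g)) (trans (cong ℤ.∣_∣ (ℚ.↥-* x y)) (ℤ.abs-* (↥ x) (↥ y)))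
    denominator : ↧ₙ (x * y) ℕ.* ℤ.∣ g ∣ ≡ ↧ₙ x ℕ.* ↧ₙ y
    denominator = trans (sym (ℤ.abs-* (↧ (x * y)) g)) (trans (cong ℤ.∣_∣ (ℚ.↧-* x y)) (ℤ.abs-* (↧ x) (↧ y)))
    1≤∣↥x↥y∣ : 1 ℕ.≤ ∣↥x∣ ℕ.* ∣↥y∣
    1≤∣↥x↥y∣ = ℕ.*-mono-≤ (1≤∣↥∣ x x≢0) (1≤∣↥∣ y y≢0)
    regroup : ∀ a b c d → (a ℤ.+ b) ℤ.- (c ℤ.+ d) ≡ (a ℤ.- c) ℤ.+ (b ℤ.- d)
    regroup = solve-∀

  1/j! : ℕ → ℚ
  1/j! j = ((+ 1) ℚ./ (j ℕ.!)) {{j ℕ.!≢0}}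

  private
    g! : ℕ → ℤ
    g! j = gcd (+ 1) (+ (j ℕ.!))

    ∣↥1/j!∣*g≡1 : ∀ j → ℤ.∣ ↥ (1/j! j) ∣ ℕ.* ℤ.∣ g! j ∣ ≡ 1
    ∣↥1/j!∣*g≡1 j = trans (sym (ℤ.abs-* (↥ (1/j! j)) (g! j))) (cong ℤ.∣_∣ (ℚ.↥-/ (+ 1) (j ℕ.!) {{j ℕ.!≢0}}))

    ↧ₙ1/j!*g≡j! : ∀ j → ↧ₙ (1/j! j) ℕ.* ℤ.∣ g! j ∣ ≡ j ℕ.!
    ↧ₙ1/j!*g≡j! j = trans (sym (ℤ.abs-* (↧ (1/j! j)) (g! j))) (cong ℤ.∣_∣ (ℚ.↧-/ (+ 1) (j ℕ.!) {{j ℕ.!≢0}}))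

  1/j!≢0 : ∀ j → 1/j! j ≢ 0ℚ
  1/j!≢0 j 1/j!≡0 = ℕ.1+n≢0 (trans (sym (∣↥1/j!∣*g≡1 j)) (cong (λ x → ℤ.∣ ↥ x ∣ ℕ.* ℤ.∣ g! j ∣) 1/j!≡0))

  ordℚ[1/j!]≡-νℕ[j!] : ∀ j → ordℚ p (1/j! j) ≡ ℤ.- + νℕ p (j ℕ.!)
  ordℚ[1/j!]≡-νℕ[j!] j =
    trans (ordℚ-fraction (1/j! j) (∣↥1/j!∣*g≡1 j) (↧ₙ1/j!*g≡j! j) (ℕ.s≤s ℕ.z≤n)) (ℤ.+-identityˡ _)

  hcoeff-≢0 : ∀ a j → a j ≢ 0ℚ → hcoeff a j ≢ 0ℚ
  hcoeff-≢0 a j aj≢0 = *-≢0 aj≢0 (1/j!≢0 j)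

  hcoeff-≢0⁻ : ∀ a j → hcoeff a j ≢ 0ℚ → a j ≢ 0ℚ
  hcoeff-≢0⁻ a j hj≢0 aj≡0 = hj≢0 (trans (cong (_* 1/j! j) aj≡0) (ℚ.*-zeroˡ (1/j! j)))

  ordℚ-hcoeff : ∀ a j → a j ≢ 0ℚ → ordℚ p (hcoeff a j) ≡ ordℚ p (a j) ℤ.+ ℤ.- + νℕ p (j ℕ.!)
  ordℚ-hcoeff a j aj≢0 = trans (ordℚ-* aj≢0 (1/j!≢0 j)) (cong (λ z → ordℚ p (a j) ℤ.+ z) (ordℚ[1/j!]≡-νℕ[j!] j))

module RationalOrder where
  open import Data.Rational as ℚ using (_+_; _*_; _-_; -_; 0ℚ; 1ℚ; _≤_; _<_)
  import Data.Rational.Properties as ℚ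
  open import Data.Rational.Solver using (module +-*-Solver)
  open import Relation.Nullary using (¬_)
  open import Relation.Binary.PropositionalEquality
  open +-*-Solver using (solve; _:+_; _:-_; _:*_; _:=_; con)

  <⇒≱ : ∀ {p q} → p < q → ¬ (q ≤ p)
  <⇒≱ p<q q≤p = ℚ.<-irrefl refl (ℚ.<-≤-trans p<q q≤p)

  p≤q⇒0≤q-p : ∀ {p q} → p ≤ q → 0ℚ ≤ q - p
  p≤q⇒0≤q-p {p} p≤q = ℚ.≤-trans (ℚ.≤-reflexive (sym (ℚ.+-inverseʳ p))) (ℚ.+-monoˡ-≤ (- p) p≤q)

  p<q⇒0<q-p : ∀ {p q} → p < q → 0ℚ < q - p
  p<q⇒0<q-p {p} p<q = ℚ.≤-<-trans (ℚ.≤-reflexive (sym (ℚ.+-inverseʳ p))) (ℚ.+-monoˡ-< (- p) p<q)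

  p<q⇒p-q<0 : ∀ {p q} → p < q → p - q < 0ℚ
  p<q⇒p-q<0 {q = q} p<q = ℚ.<-≤-trans (ℚ.+-monoˡ-< (- q) p<q) (ℚ.≤-reflexive (ℚ.+-inverseʳ q))

  *-monoˡ-≤-0≤ : ∀ {r p q} → 0ℚ ≤ r → p ≤ q → r * p ≤ r * q
  *-monoˡ-≤-0≤ {r} 0≤r = ℚ.*-monoˡ-≤-nonNeg r {{ℚ.nonNegative 0≤r}}

  *-monoˡ-<-0< : ∀ {r p q} → 0ℚ < r → p < q → r * p < r * q
  *-monoˡ-<-0< {r} 0<r = ℚ.*-monoʳ-<-pos r {{ℚ.positive 0<r}}

  *-monoʳ-<-0< : ∀ {r p q} → 0ℚ < r → p < q → p * r < q * r
  *-monoʳ-<-0< {r} 0<r = ℚ.*-monoˡ-<-pos r {{ℚ.positive 0<r}}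

  *-monoʳ-<-<0 : ∀ {r p q} → r < 0ℚ → p < q → q * r < p * r
  *-monoʳ-<-<0 {r} r<0 = ℚ.*-monoˡ-<-neg r {{ℚ.negative r<0}}

  *-cancelˡ-≤-0< : ∀ {r p q} → 0ℚ < r → r * p ≤ r * q → p ≤ q
  *-cancelˡ-≤-0< {r} 0<r = ℚ.*-cancelˡ-≤-pos r {{ℚ.positive 0<r}}

  *-cancelˡ-<-0≤ : ∀ {r p q} → 0ℚ ≤ r → r * p < r * q → p < q
  *-cancelˡ-<-0≤ {r} 0≤r = ℚ.*-cancelˡ-<-nonNeg r {{ℚ.nonNegative 0≤r}}

  *-cancelˡ-≡-0< : ∀ {r p q} → 0ℚ < r → r * p ≡ r * q → p ≡ q
  *-cancelˡ-≡-0< 0<r rp≡rq = ℚ.≤-antisym (*-cancelˡ-≤-0< 0<r (ℚ.≤-reflexive rp≡rq)) (*-cancelˡ-≤-0< 0<r (ℚ.≤-reflexive (sym rp≡rq)))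

  convex-mono-≤ : ∀ {t a a′ b b′} → 0ℚ ≤ t → t ≤ 1ℚ → a ≤ a′ → b ≤ b′ →
    (1ℚ - t) * a + t * b ≤ (1ℚ - t) * a′ + t * b′
  convex-mono-≤ 0≤t t≤1 a≤a′ b≤b′ = ℚ.+-mono-≤ (*-monoˡ-≤-0≤ (p≤q⇒0≤q-p t≤1) a≤a′) (*-monoˡ-≤-0≤ 0≤t b≤b′)

  convex-const : ∀ t m → (1ℚ - t) * m + t * m ≡ m
  convex-const = solve 2 (λ t m → (con 1ℚ :- t) :* m :+ t :* m := m) refl

module NewtonPolygon where
  open import Data.Nat as ℕ using (zero; suc; z≤n; s≤s)
  import Data.Nat.Properties as ℕ
  open import Data.Rational as ℚ using (_+_; _*_; _-_; -_; 0ℚ; 1ℚ; 1/_; _≤_; _<_)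
  import Data.Rational.Properties as ℚ
  open import Data.Rational.Solver using (module +-*-Solver)
  open import Data.Product using (∃-syntax; _×_; _,_; proj₁; proj₂)
  open import Data.Sum using (_⊎_; inj₁; inj₂)
  open import Data.Empty using (⊥-elim)
  open import Function using (_∘_)
  open import Relation.Nullary using (¬_; yes; no; _⊎-dec_)
  open import Relation.Unary using (Decidable)
  open import Relation.Binary.Definitions using (tri<; tri≈; tri>)
  open import Relation.Binary.PropositionalEquality hiding (J)
  open +-*-Solver using (solve; _:+_; _:-_; _:*_; _:=_; con)
  open Embedding
  open RationalOrder

  ∃-crossing : ∀ {P : ℕ → Set} → Decidable P → P 0 → ∀ s → ¬ P s → ∃[ i ] i ℕ.< s × P i × ¬ P (suc i)
  ∃-crossing P? P0 zero    ¬P0     = ⊥-elim (¬P0 P0)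
  ∃-crossing P? P0 (suc s) ¬P[1+s] with P? s
  ... | yes Ps  = s , ℕ.≤-refl , Ps , ¬P[1+s]
  ... | no  ¬Ps with ∃-crossing P? P0 s ¬Ps
  ...   | i , i<s , Pi , ¬P[1+i] = i , ℕ.m<n⇒m<1+n i<s , Pi , ¬P[1+i]

  module ConvexMinorant
    (p n : ℕ) (1≤n : 1 ℕ.≤ n)
    (Z : ℕ → ℚ) (s : ℕ) (k : ℕ → ℕ) (μ : ℕ → ℚ)
    (k[0]≡0 : k 0 ≡ 0) (k[s]≡n : k s ≡ n)
    (k-increasing : ∀ i → i ℕ.< s → k i ℕ.< k (suc i))
    (line-below : ∀ i → i ℕ.< s → ∀ j → j ℕ.≤ n → Z (k i) + μ i * (ℕ→ℚ j - ℕ→ℚ (k i)) ≤ Z j)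
    (line-through : ∀ i → i ℕ.< s → Z (k (suc i)) ≡ Z (k i) + μ i * (ℕ→ℚ (k (suc i)) - ℕ→ℚ (k i)))
    (μ-increasing : ∀ i → suc i ℕ.< s → μ i < μ (suc i))
    where

    line : ℕ → ℚ → ℚ
    line i x = Z (k i) + μ i * (x - ℕ→ℚ (k i))

    record Supports (c : ℕ → ℚ) : Set where
      field
        above   : ∀ j → j ℕ.≤ n → c j ≢ 0ℚ → Z j ≤ vert p c j
        knot≢0  : ∀ i → i ℕ.≤ s → c (k i) ≢ 0ℚ
        on-knot : ∀ i → i ℕ.≤ s → vert p c (k i) ≡ Z (k i)

      line≤vert : ∀ i → i ℕ.< s → ∀ j → j ℕ.≤ n → c j ≢ 0ℚ → line i (ℕ→ℚ j) ≤ vert p c j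
      line≤vert i i<s j j≤n cj≢0 = ℚ.≤-trans (line-below i i<s j j≤n) (above j j≤n cj≢0)

    k-mono-≤ : ∀ {i i′} → i ℕ.≤ i′ → i′ ℕ.≤ s → k i ℕ.≤ k i′
    k-mono-≤ {i′ = zero}   z≤n      _      = ℕ.≤-refl
    k-mono-≤ {i′ = suc i′} i≤1+i′ 1+i′≤s with ℕ.m≤n⇒m<n∨m≡n i≤1+i′
    ... | inj₁ (s≤s i≤i′) = ℕ.≤-trans (k-mono-≤ i≤i′ (ℕ.<⇒≤ 1+i′≤s)) (ℕ.<⇒≤ (k-increasing i′ 1+i′≤s))
    ... | inj₂ refl       = ℕ.≤-refl

    k-mono-< : ∀ {i i′} → i ℕ.< i′ → i′ ℕ.≤ s → k i ℕ.< k i′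
    k-mono-< {i} i<i′ i′≤s = ℕ.<-≤-trans (k-increasing i (ℕ.<-≤-trans i<i′ i′≤s)) (k-mono-≤ i<i′ i′≤s)

    k≤n : ∀ {i} → i ℕ.≤ s → k i ℕ.≤ n
    k≤n i≤s = subst (k _ ℕ.≤_) k[s]≡n (k-mono-≤ i≤s ℕ.≤-refl)

    1≤s : 1 ℕ.≤ s
    1≤s = ℕ.n≢0⇒n>0 (λ s≡0 → ℕ.<⇒≱ 1≤n (ℕ.≤-reflexive (trans (sym k[s]≡n) (trans (cong k s≡0) k[0]≡0))))

    locate-ℕ : ∀ {j} → j ℕ.≤ n →
      (∃[ i ] i ℕ.≤ s × j ≡ k i) ⊎ (∃[ i ] i ℕ.< s × k i ℕ.< j × j ℕ.< k (suc i))
    locate-ℕ {j} j≤n with ℕ.m≤n⇒m<n∨m≡n j≤n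
    ... | inj₂ j≡n = inj₁ (s , ℕ.≤-refl , trans j≡n (sym k[s]≡n))
    ... | inj₁ j<n with ∃-crossing (λ i → k i ℕ.≤? j) (subst (ℕ._≤ j) (sym k[0]≡0) z≤n) s
                          (λ k[s]≤j → ℕ.<⇒≱ j<n (subst (ℕ._≤ j) k[s]≡n k[s]≤j))
    ...   | i , i<s , k[i]≤j , k[1+i]≰j with ℕ.m≤n⇒m<n∨m≡n k[i]≤j
    ...     | inj₁ k[i]<j = inj₂ (i , i<s , k[i]<j , ℕ.≰⇒> k[1+i]≰j)
    ...     | inj₂ k[i]≡j = inj₁ (i , ℕ.<⇒≤ i<s , sym k[i]≡j)

    locate-ℚ : ∀ {x} → 0ℚ ≤ x → x ≤ ℕ→ℚ n → ∃[ i ] i ℕ.< s × ℕ→ℚ (k i) ≤ x × x ≤ ℕ→ℚ (k (suc i))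
    locate-ℚ {x} 0≤x x≤n with ∃-crossing (λ i → (i ℕ.≟ 0) ⊎-dec (ℕ→ℚ (k i) ℚ.<? x)) (inj₁ refl) s ¬P[s]
      where
      ¬P[s] : ¬ (s ≡ 0 ⊎ ℕ→ℚ (k s) < x)
      ¬P[s] (inj₁ s≡0)    = ℕ.<⇒≢ 1≤s (sym s≡0)
      ¬P[s] (inj₂ k[s]<x) = <⇒≱ k[s]<x (subst (λ m → x ≤ ℕ→ℚ m) (sym k[s]≡n) x≤n)
    ... | i , i<s , P[i] , ¬P[1+i] = i , i<s , k[i]≤x P[i] , ℚ.≮⇒≥ (¬P[1+i] ∘ inj₂)
      where
      k[i]≤x : ∀ {i} → i ≡ 0 ⊎ ℕ→ℚ (k i) < x → ℕ→ℚ (k i) ≤ x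
      k[i]≤x (inj₁ refl)   = subst (λ m → ℕ→ℚ m ≤ x) (sym k[0]≡0) (subst (_≤ x) (sym ℕ→ℚ[0]≡0) 0≤x)
      k[i]≤x (inj₂ k[i]<x) = ℚ.<⇒≤ k[i]<x

    private
      line-affine : ∀ (Zk m a b K t : ℚ) →
        Zk + m * (((1ℚ - t) * a + t * b) - K) ≡ (1ℚ - t) * (Zk + m * (a - K)) + t * (Zk + m * (b - K))
      line-affine = solve 6 (λ Zk m a b K t →
        Zk :+ m :* (((con 1ℚ :- t) :* a :+ t :* b) :- K) := (con 1ℚ :- t) :* (Zk :+ m :* (a :- K)) :+ t :* (Zk :+ m :* (b :- K))) refl

      interpolate : ∀ (K K′ t : ℚ) → (1ℚ - t) * K + t * K′ ≡ K + t * (K′ - K)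
      interpolate = solve 3 (λ K K′ t → (con 1ℚ :- t) :* K :+ t :* K′ := K :+ t :* (K′ :- K)) refl

      interpolate-line : ∀ (ZK m D t : ℚ) → (1ℚ - t) * ZK + t * (ZK + m * D) ≡ ZK + m * (t * D)
      interpolate-line = solve 4 (λ ZK m D t → (con 1ℚ :- t) :* ZK :+ t :* (ZK :+ m :* D) := ZK :+ m :* (t :* D)) refl

      K+[x-K]≡x : ∀ (K x : ℚ) → K + (x - K) ≡ x
      K+[x-K]≡x = solve 2 (λ K x → K :+ (x :- K) := x) refl

    segPoint-range : ∀ {c x y} → SegPoint p c n x y → 0ℚ ≤ x × x ≤ ℕ→ℚ n
    segPoint-range (a , b , t , a≤n , b≤n , _ , _ , 0≤t , t≤1 , refl , _) =
      ℚ.≤-trans (ℚ.≤-reflexive (sym (convex-const t 0ℚ))) (convex-mono-≤ 0≤t t≤1 (0≤ℕ→ℚ a) (0≤ℕ→ℚ b)) ,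
      ℚ.≤-trans (convex-mono-≤ 0≤t t≤1 (ℕ→ℚ-mono-≤ a≤n) (ℕ→ℚ-mono-≤ b≤n)) (ℚ.≤-reflexive (convex-const t (ℕ→ℚ n)))

    line≤segPoint : ∀ {c x y} → Supports c → ∀ i → i ℕ.< s → SegPoint p c n x y → line i x ≤ y
    line≤segPoint supp i i<s (a , b , t , a≤n , b≤n , ca≢0 , cb≢0 , 0≤t , t≤1 , refl , refl) =
      ℚ.≤-trans (ℚ.≤-reflexive (line-affine (Z (k i)) (μ i) (ℕ→ℚ a) (ℕ→ℚ b) (ℕ→ℚ (k i)) t))
        (convex-mono-≤ 0≤t t≤1 (line≤vert i i<s a a≤n ca≢0) (line≤vert i i<s b b≤n cb≢0))
      where open Supports supp

    segPoint-line : ∀ {c x} → Supports c → ∀ i → i ℕ.< s →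
      ℕ→ℚ (k i) ≤ x → x ≤ ℕ→ℚ (k (suc i)) → SegPoint p c n x (line i x)
    segPoint-line {c} {x} supp i i<s K≤x x≤K′ =
      k i , k (suc i) , t , k≤n (ℕ.<⇒≤ i<s) , k≤n i<s , knot≢0 i (ℕ.<⇒≤ i<s) , knot≢0 (suc i) i<s ,
      0≤t , t≤1 , x≡ , y≡
      where
      open Supports supp
      K  = ℕ→ℚ (k i)
      K′ = ℕ→ℚ (k (suc i))
      Δ  = K′ - K
      0<Δ : 0ℚ < Δ
      0<Δ = p<q⇒0<q-p (ℕ→ℚ-mono-< (k-increasing i i<s))
      instance
        Δ≢0 : ℚ.NonZero Δ
        Δ≢0 = ℚ.pos⇒nonZero Δ {{ℚ.positive 0<Δ}}
      0≤1/Δ : 0ℚ ≤ 1/ Δ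
      0≤1/Δ = ℚ.<⇒≤ (ℚ.positive⁻¹ (1/ Δ) {{ℚ.1/pos⇒pos Δ {{ℚ.positive 0<Δ}}}})
      t = (x - K) * 1/ Δ
      0≤t : 0ℚ ≤ t
      0≤t = subst (_≤ t) (ℚ.*-zeroˡ (1/ Δ)) (ℚ.*-monoʳ-≤-nonNeg (1/ Δ) {{ℚ.nonNegative 0≤1/Δ}} (p≤q⇒0≤q-p K≤x))
      t≤1 : t ≤ 1ℚ
      t≤1 = subst (t ≤_) (ℚ.*-inverseʳ Δ) (ℚ.*-monoʳ-≤-nonNeg (1/ Δ) {{ℚ.nonNegative 0≤1/Δ}} (ℚ.+-monoˡ-≤ (- K) x≤K′))
      t*Δ≡x-K : t * Δ ≡ x - K
      t*Δ≡x-K = trans (ℚ.*-assoc (x - K) (1/ Δ) Δ) (trans (cong ((x - K) *_) (ℚ.*-inverseˡ Δ)) (ℚ.*-identityʳ (x - K)))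
      x≡ : x ≡ (1ℚ - t) * K + t * K′
      x≡ = sym (trans (interpolate K K′ t) (trans (cong (K +_) t*Δ≡x-K) (K+[x-K]≡x K x)))
      y≡ : line i x ≡ (1ℚ - t) * vert p c (k i) + t * vert p c (k (suc i))
      y≡ = sym (begin
        (1ℚ - t) * vert p c (k i) + t * vert p c (k (suc i)) ≡⟨ cong₂ (λ u v → (1ℚ - t) * u + t * v) (on-knot i (ℕ.<⇒≤ i<s)) (trans (on-knot (suc i) i<s) (line-through i i<s)) ⟩
        (1ℚ - t) * Z (k i) + t * (Z (k i) + μ i * Δ)         ≡⟨ interpolate-line (Z (k i)) (μ i) Δ t ⟩
        Z (k i) + μ i * (t * Δ)                              ≡⟨ cong (λ d → Z (k i) + μ i * d) t*Δ≡x-K ⟩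
        line i x                                             ∎)
        where open ≡-Reasoning

    npValue-line : ∀ {c x} → Supports c → ∀ i → i ℕ.< s →
      ℕ→ℚ (k i) ≤ x → x ≤ ℕ→ℚ (k (suc i)) → NPValue p c n x (line i x)
    npValue-line supp i i<s K≤x x≤K′ = segPoint-line supp i i<s K≤x x≤K′ , λ y → line≤segPoint supp i i<s

    npValue-transfer : ∀ {c d x y} → Supports c → Supports d → NPValue p c n x y → NPValue p d n x y
    npValue-transfer {c} {d} {x} {y} supp-c supp-d (seg , minimal) =
      subst (NPValue p d n x) (sym y≡line) (npValue-line supp-d i i<s K≤x x≤K′)
      where
      located = locate-ℚ (proj₁ (segPoint-range seg)) (proj₂ (segPoint-range seg))
      i   = proj₁ located
      i<s = proj₁ (proj₂ located)
      K≤x = proj₁ (proj₂ (proj₂ located))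
      x≤K′ = proj₂ (proj₂ (proj₂ located))
      y≡line : y ≡ line i x
      y≡line = ℚ.≤-antisym (minimal (line i x) (segPoint-line supp-c i i<s K≤x x≤K′)) (line≤segPoint supp-c i i<s seg)

    private
      chord-step : ∀ (A m Ki Ki′ J : ℚ) → A + m * (Ki - Ki′) + m * (J - Ki) ≡ A + m * (J - Ki′)
      chord-step = solve 5 (λ A m Ki Ki′ J → A :+ m :* (Ki :- Ki′) :+ m :* (J :- Ki) := A :+ m :* (J :- Ki′)) refl

      lt+1 : ∀ x → x < x + 1ℚ
      lt+1 x = ℚ.≤-<-trans (ℚ.≤-reflexive (sym (ℚ.+-identityʳ x))) (ℚ.+-monoʳ-< x (ℚ.positive⁻¹ 1ℚ))

      x-1<x : ∀ x → x - 1ℚ < x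
      x-1<x x = ℚ.<-≤-trans (lt+1 (x - 1ℚ)) (ℚ.≤-reflexive (solve 1 (λ x → x :- con 1ℚ :+ con 1ℚ := x) refl x))

    supporting-slope : ∀ i → i ℕ.≤ s → ∃[ m ] (∀ {i′} → i ≡ suc i′ → μ i′ < m) × (i ℕ.< s → m < μ i)
    supporting-slope zero    _ = μ 0 - 1ℚ , (λ ()) , (λ _ → x-1<x (μ 0))
    supporting-slope (suc i) _ with suc i ℕ.<? s
    ... | yes 1+i<s = let m , μi<m , m<μ[1+i] = ℚ.<-dense (μ-increasing i 1+i<s)
                      in m , (λ { refl → μi<m }) , (λ _ → m<μ[1+i])
    ... | no  1+i≮s = μ i + 1ℚ , (λ { refl → lt+1 (μ i) }) , (λ 1+i<s → ⊥-elim (1+i≮s 1+i<s))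

    knot-isBreak : ∀ {c} → Supports c → ∀ i → i ℕ.≤ s → IsBreak p c n (k i)
    knot-isBreak {c} supp i i≤s = k≤n i≤s , knot≢0 i i≤s , m , below
      where
      open Supports supp
      open ℚ.≤-Reasoning
      slope = supporting-slope i i≤s
      m = proj₁ slope
      K = ℕ→ℚ (k i)
      below : ∀ j → j ℕ.≤ n → c j ≢ 0ℚ → j ≢ k i → vert p c (k i) + m * (ℕ→ℚ j - K) < vert p c j
      below j j≤n cj≢0 j≢k with ℕ.<-cmp j (k i)
      ... | tri≈ _ j≡k _ = ⊥-elim (j≢k j≡k)
      ... | tri< j<k _ _ = left-of-knot i refl i≤s j<k
        where
        left-of-knot : ∀ i″ → i″ ≡ i → i″ ℕ.≤ s → j ℕ.< k i″ → vert p c (k i) + m * (ℕ→ℚ j - K) < vert p c j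
        left-of-knot zero     _    _      j<k[0] = ⊥-elim (ℕ.n≮0 (subst (j ℕ.<_) k[0]≡0 j<k[0]))
        left-of-knot (suc i′) refl 1+i′≤s _ = begin-strict
          vert p c (k i) + m * (ℕ→ℚ j - K)                        ≡⟨ cong (_+ m * (ℕ→ℚ j - K)) (trans (on-knot i i≤s) (line-through i′ 1+i′≤s)) ⟩
          Z (k i′) + μ i′ * (K - ℕ→ℚ (k i′)) + m * (ℕ→ℚ j - K)     <⟨ ℚ.+-monoʳ-< (Z (k i′) + μ i′ * (K - ℕ→ℚ (k i′))) (*-monoʳ-<-<0 (p<q⇒p-q<0 (ℕ→ℚ-mono-< j<k)) (proj₁ (proj₂ slope) refl)) ⟩
          Z (k i′) + μ i′ * (K - ℕ→ℚ (k i′)) + μ i′ * (ℕ→ℚ j - K)  ≡⟨ chord-step (Z (k i′)) (μ i′) K (ℕ→ℚ (k i′)) (ℕ→ℚ j) ⟩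
          line i′ (ℕ→ℚ j)                                         ≤⟨ line≤vert i′ 1+i′≤s j j≤n cj≢0 ⟩
          vert p c j                                              ∎
      ... | tri> _ _ k<j = begin-strict
          vert p c (k i) + m * (ℕ→ℚ j - K)   ≡⟨ cong (_+ m * (ℕ→ℚ j - K)) (on-knot i i≤s) ⟩
          Z (k i) + m * (ℕ→ℚ j - K)          <⟨ ℚ.+-monoʳ-< (Z (k i)) (*-monoʳ-<-0< (p<q⇒0<q-p (ℕ→ℚ-mono-< k<j)) (proj₂ (proj₂ slope) i<s)) ⟩
          line i (ℕ→ℚ j)                     ≤⟨ line≤vert i i<s j j≤n cj≢0 ⟩
          vert p c j                         ∎
        where
        i<s : i ℕ.< s
        i<s with ℕ.m≤n⇒m<n∨m≡n i≤s
        ... | inj₁ i<s = i<s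
        ... | inj₂ refl = ⊥-elim (ℕ.<⇒≱ k<j (subst (j ℕ.≤_) (sym k[s]≡n) j≤n))

    private
      weigh-left : ∀ (y m K K′ J : ℚ) →
        (K′ - J) * (y + m * (K - J)) + (J - K) * (y + m * (K′ - J)) ≡ (K′ - K) * y
      weigh-left = solve 5 (λ y m K K′ J →
        (K′ :- J) :* (y :+ m :* (K :- J)) :+ (J :- K) :* (y :+ m :* (K′ :- J)) := (K′ :- K) :* y) refl

      weigh-right : ∀ (ZK m K K′ J : ℚ) →
        (K′ - J) * ZK + (J - K) * (ZK + m * (K′ - K)) ≡ (K′ - K) * (ZK + m * (J - K))
      weigh-right = solve 5 (λ ZK m K K′ J →
        (K′ :- J) :* ZK :+ (J :- K) :* (ZK :+ m :* (K′ :- K)) := (K′ :- K) :* (ZK :+ m :* (J :- K))) refl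

    -- Weighting the two strict inequalities at the neighbouring knots by (K′ - j) and (j - K)
    -- puts (j , vert j) strictly below the edge, which lies below every point.
    ¬isBreak-between : ∀ {c} → Supports c → ∀ i → i ℕ.< s → ∀ j → k i ℕ.< j → j ℕ.< k (suc i) → ¬ IsBreak p c n j
    ¬isBreak-between {c} supp i i<s j k<j j<k′ (j≤n , cj≢0 , m , exposed) = <⇒≱ below-edge above-edge
      where
      open Supports supp
      K  = ℕ→ℚ (k i)
      K′ = ℕ→ℚ (k (suc i))
      J  = ℕ→ℚ j
      y  = vert p c j
      at-K : y + m * (K - J) < Z (k i)
      at-K = subst (y + m * (K - J) <_) (on-knot i (ℕ.<⇒≤ i<s))
        (exposed (k i) (k≤n (ℕ.<⇒≤ i<s)) (knot≢0 i (ℕ.<⇒≤ i<s)) (ℕ.<⇒≢ k<j))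
      at-K′ : y + m * (K′ - J) < Z (k i) + μ i * (K′ - K)
      at-K′ = subst (y + m * (K′ - J) <_) (trans (on-knot (suc i) i<s) (line-through i i<s))
        (exposed (k (suc i)) (k≤n i<s) (knot≢0 (suc i) i<s) (ℕ.>⇒≢ j<k′))
      below-edge : (K′ - K) * y < (K′ - K) * line i J
      below-edge = subst₂ _<_ (weigh-left y m K K′ J) (weigh-right (Z (k i)) (μ i) K K′ J)
        (ℚ.+-mono-< (*-monoˡ-<-0< (p<q⇒0<q-p (ℕ→ℚ-mono-< j<k′)) at-K) (*-monoˡ-<-0< (p<q⇒0<q-p (ℕ→ℚ-mono-< k<j)) at-K′))
      above-edge : (K′ - K) * line i J ≤ (K′ - K) * y
      above-edge = *-monoˡ-≤-0≤ (p≤q⇒0≤q-p (ℕ→ℚ-mono-≤ (ℕ.<⇒≤ (k-increasing i i<s)))) (line≤vert i i<s j j≤n cj≢0)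

    isBreak⇒knot : ∀ {c j} → Supports c → IsBreak p c n j → ∃[ i ] i ℕ.≤ s × j ≡ k i
    isBreak⇒knot supp isBreak with locate-ℕ (proj₁ isBreak)
    ... | inj₁ knot                   = knot
    ... | inj₂ (i , i<s , k<j , j<k′) = ⊥-elim (¬isBreak-between supp i i<s _ k<j j<k′ isBreak)

    consecutiveBreaks⇒edge : ∀ {c b b′} → Supports c → ConsecutiveBreaks p c n b b′ →
      ∃[ i ] i ℕ.< s × b ≡ k i × b′ ≡ k (suc i)
    consecutiveBreaks⇒edge {b = b} {b′} supp (isBreak-b , isBreak-b′ , b<b′ , nothing-between)
      with isBreak⇒knot supp isBreak-b | isBreak⇒knot supp isBreak-b′
    ... | i , i≤s , refl | i′ , i′≤s , refl with i ℕ.<? i′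
    ...   | no i≮i′ = ⊥-elim (ℕ.<⇒≱ b<b′ (k-mono-≤ (ℕ.≮⇒≥ i≮i′) i≤s))
    ...   | yes i<i′ with ℕ.m≤n⇒m<n∨m≡n i<i′
    ...     | inj₂ refl    = i , i′≤s , refl , refl
    ...     | inj₁ 1+i<i′ = ⊥-elim (nothing-between (k (suc i))
                              (k-increasing i (ℕ.<-≤-trans i<i′ i′≤s)) (k-mono-< 1+i<i′ i′≤s)
                              (knot-isBreak supp (suc i) (ℕ.≤-trans i<i′ i′≤s)))

    edge-slope : ∀ {c} → Supports c → ∀ i → i ℕ.< s → ∀ σ →
      σ * (ℕ→ℚ (k (suc i)) - ℕ→ℚ (k i)) ≡ vert p c (k (suc i)) - vert p c (k i) → σ ≡ μ i
    edge-slope {c} supp i i<s σ σ-rise = *-cancelˡ-≡-0< 0<Δ (begin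
      Δ * σ                                 ≡⟨ ℚ.*-comm Δ σ ⟩
      σ * Δ                                 ≡⟨ σ-rise ⟩
      vert p c (k (suc i)) - vert p c (k i) ≡⟨ cong₂ _-_ (trans (on-knot (suc i) i<s) (line-through i i<s)) (on-knot i (ℕ.<⇒≤ i<s)) ⟩
      Z (k i) + μ i * Δ - Z (k i)           ≡⟨ solve 2 (λ z d → z :+ d :- z := d) refl (Z (k i)) (μ i * Δ) ⟩
      μ i * Δ                               ≡⟨ ℚ.*-comm (μ i) Δ ⟩
      Δ * μ i                               ∎)
      where
      open Supports supp
      open ≡-Reasoning
      Δ = ℕ→ℚ (k (suc i)) - ℕ→ℚ (k i)
      0<Δ : 0ℚ < Δ
      0<Δ = p<q⇒0<q-p (ℕ→ℚ-mono-< (k-increasing i i<s))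

module SlopeArithmetic where
  open import Data.Nat as ℕ using (_∸_)
  import Data.Nat.Properties as ℕ
  open import Data.Nat.Divisibility using (_∣_; ∣m+n∣m⇒∣n; m∣m*n; n∣m*n; ∣n⇒∣m*n)
  open import Data.Integer as ℤ using (+_)
  import Data.Integer.Properties as ℤ
  open import Data.Rational as ℚ using (_+_; _*_; _-_; -_; 0ℚ; 1ℚ; _≤_; _<_; ↥_; ↧_; ↧ₙ_)
  import Data.Rational.Properties as ℚ
  open import Data.Rational.Solver using (module +-*-Solver)
  open import Relation.Binary.PropositionalEquality hiding (J)
  open +-*-Solver using (solve; _:+_; _:-_; _:*_; _:=_; con; :-_)
  open Embedding
  open RationalOrder

  -- Read δ = p - 1, P = p^e and μ = (1 - P) / (δ P); a hypothesis s + δ T ≡ K is Legendre's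
  -- formula s_p(K) + (p - 1) ord_p(K!) = K.
  module Edge (δ P μ : ℚ) (0<δP : 0ℚ < δ * P) (μδP≡1-P : μ * (δ * P) ≡ 1ℚ - P) where

    private
      expand : ∀ (δ P μ TK J K : ℚ) → (δ * P) * (- TK + μ * (J - K)) ≡ - ((δ * P) * TK) + (μ * (δ * P)) * (J - K)
      expand = solve 6 (λ δ P μ TK J K → (δ :* P) :* (:- TK :+ μ :* (J :- K)) := :- ((δ :* P) :* TK) :+ (μ :* (δ :* P)) :* (J :- K)) refl

      scaled : ∀ TK J K → (δ * P) * (- TK + μ * (J - K)) ≡ - ((δ * P) * TK) + (1ℚ - P) * (J - K)
      scaled TK J K = trans (expand δ P μ TK J K) (cong (λ r → - ((δ * P) * TK) + r * (J - K)) μδP≡1-P)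

    line-below : ∀ sK sJ TK TJ {K J} → sK + δ * TK ≡ K → sJ + δ * TJ ≡ J → P * sK + J ≤ P * sJ + K →
      - TK + μ * (J - K) ≤ - TJ
    line-below sK sJ TK TJ refl refl PsK+J≤PsJ+K = *-cancelˡ-≤-0< 0<δP (begin
      (δ * P) * (- TK + μ * (J - K))                              ≡⟨ scaled TK J K ⟩
      - ((δ * P) * TK) + (1ℚ - P) * (J - K)                       ≤⟨ x≤x+gap ⟩
      - ((δ * P) * TK) + (1ℚ - P) * (J - K) + ((P * sJ + K) - (P * sK + J)) ≡⟨ collect δ P sK sJ TK TJ ⟩
      (δ * P) * (- TJ)                                            ∎)
      where
      open ℚ.≤-Reasoning
      K = sK + δ * TK
      J = sJ + δ * TJ
      x≤x+gap : ∀ {x} → x ≤ x + ((P * sJ + K) - (P * sK + J))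
      x≤x+gap {x} = ℚ.≤-trans (ℚ.≤-reflexive (sym (ℚ.+-identityʳ x))) (ℚ.+-monoʳ-≤ x (p≤q⇒0≤q-p PsK+J≤PsJ+K))
      collect : ∀ (δ P sK sJ TK TJ : ℚ) →
        - ((δ * P) * TK) + (1ℚ - P) * ((sJ + δ * TJ) - (sK + δ * TK)) + ((P * sJ + (sK + δ * TK)) - (P * sK + (sJ + δ * TJ)))
          ≡ (δ * P) * (- TJ)
      collect = solve 6 (λ δ P sK sJ TK TJ →
        :- ((δ :* P) :* TK) :+ (con 1ℚ :- P) :* ((sJ :+ δ :* TJ) :- (sK :+ δ :* TK)) :+ ((P :* sJ :+ (sK :+ δ :* TK)) :- (P :* sK :+ (sJ :+ δ :* TJ)))
          := (δ :* P) :* (:- TJ)) refl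

    line-through : ∀ sK TK TK′ b {K} → sK + δ * TK ≡ K → (sK + b) + δ * TK′ ≡ K + b * P →
      - TK′ ≡ - TK + μ * ((K + b * P) - K)
    line-through sK TK TK′ b refl legendre′ = *-cancelˡ-≡-0< 0<δP (begin
      (δ * P) * (- TK′)                              ≡⟨ solve 3 (λ δ P T → (δ :* P) :* (:- T) := :- (P :* (δ :* T))) refl δ P TK′ ⟩
      - (P * (δ * TK′))                              ≡⟨ cong (λ x → - (P * x)) δTK′≡ ⟩
      - (P * ((K + b * P) - (sK + b)))               ≡⟨ collect δ P sK TK b ⟩
      - ((δ * P) * TK) + (1ℚ - P) * ((K + b * P) - K) ≡⟨ scaled TK (K + b * P) K ⟨
      (δ * P) * (- TK + μ * ((K + b * P) - K))       ∎)
      where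
      open ≡-Reasoning
      K = sK + δ * TK
      δTK′≡ : δ * TK′ ≡ (K + b * P) - (sK + b)
      δTK′≡ = trans (solve 2 (λ x y → y := (x :+ y) :- x) refl (sK + b) (δ * TK′)) (cong (_- (sK + b)) legendre′)
      collect : ∀ (δ P sK TK b : ℚ) →
        - (P * (((sK + δ * TK) + b * P) - (sK + b))) ≡ - ((δ * P) * TK) + (1ℚ - P) * (((sK + δ * TK) + b * P) - (sK + δ * TK))
      collect = solve 5 (λ δ P sK TK b →
        :- (P :* (((sK :+ δ :* TK) :+ b :* P) :- (sK :+ b))) := :- ((δ :* P) :* TK) :+ (con 1ℚ :- P) :* (((sK :+ δ :* TK) :+ b :* P) :- (sK :+ δ :* TK))) refl

  slope-increasing : ∀ {δ P P′ μ μ′} → 0ℚ < δ → 0ℚ < P′ → P′ < P →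
    μ * (δ * P) ≡ 1ℚ - P → μ′ * (δ * P′) ≡ 1ℚ - P′ → μ < μ′
  slope-increasing {δ} {P} {P′} {μ} {μ′} 0<δ 0<P′ P′<P μδP≡ μ′δP′≡ = *-cancelˡ-<-0≤ (ℚ.<⇒≤ 0<r) (begin-strict
    r * μ                   ≡⟨ solve 4 (λ δ P P′ μ → ((δ :* P) :* (δ :* P′)) :* μ := (μ :* (δ :* P)) :* (δ :* P′)) refl δ P P′ μ ⟩
    (μ * (δ * P)) * (δ * P′) ≡⟨ cong (_* (δ * P′)) μδP≡ ⟩
    (1ℚ - P) * (δ * P′)      <⟨ widen ⟩
    (1ℚ - P′) * (δ * P)      ≡⟨ cong (_* (δ * P)) μ′δP′≡ ⟨
    (μ′ * (δ * P′)) * (δ * P) ≡⟨ solve 4 (λ δ P P′ μ′ → (μ′ :* (δ :* P′)) :* (δ :* P) := ((δ :* P) :* (δ :* P′)) :* μ′) refl δ P P′ μ′ ⟩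
    r * μ′                  ∎)
    where
    open ℚ.≤-Reasoning
    r = (δ * P) * (δ * P′)
    0<* : ∀ {x y} → 0ℚ < x → 0ℚ < y → 0ℚ < x * y
    0<* {x} {y} 0<x 0<y = subst (_< x * y) (ℚ.*-zeroʳ x) (*-monoˡ-<-0< 0<x 0<y)
    0<r : 0ℚ < r
    0<r = 0<* (0<* 0<δ (ℚ.<-trans 0<P′ P′<P)) (0<* 0<δ 0<P′)
    widen : (1ℚ - P) * (δ * P′) < (1ℚ - P′) * (δ * P)
    widen = subst₂ _<_ (ℚ.+-identityʳ ((1ℚ - P) * (δ * P′)))
      (solve 3 (λ δ P P′ → (con 1ℚ :- P) :* (δ :* P′) :+ δ :* (P :- P′) := (con 1ℚ :- P′) :* (δ :* P)) refl δ P P′)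
      (ℚ.+-monoʳ-< ((1ℚ - P) * (δ * P′)) (0<* 0<δ (p<q⇒0<q-p P′<P)))

  σ*dP≡1-P⇒P∣↧σ : ∀ {σ d P} → 1 ℕ.≤ P → σ * ℕ→ℚ (d ℕ.* P) ≡ ℤ→ℚ (+ 1 ℤ.- + P) → P ∣ ↧ₙ σ
  σ*dP≡1-P⇒P∣↧σ {σ} {d} {P} 1≤P σdP≡1-P = ∣m+n∣m⇒∣n (subst (P ∣_) P*x≡ (m∣m*n x)) P∣[P-1]*x
    where
    x = ↧ₙ σ
    ∣1-P∣≡P-1 : ℤ.∣ + 1 ℤ.- + P ∣ ≡ P ∸ 1
    ∣1-P∣≡P-1 = trans (cong ℤ.∣_∣ (ℤ.m-n≡m⊖n 1 P)) (ℤ.∣⊖∣-≤ 1≤P)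
    cross : ℤ.∣ ↥ σ ∣ ℕ.* (d ℕ.* P) ≡ (P ∸ 1) ℕ.* x
    cross = begin
      ℤ.∣ ↥ σ ∣ ℕ.* (d ℕ.* P)        ≡⟨ ℤ.abs-* (↥ σ) (+ (d ℕ.* P)) ⟨
      ℤ.∣ ↥ σ ℤ.* + (d ℕ.* P) ∣      ≡⟨ cong ℤ.∣_∣ (x*d≡z⇒↥x*d≡z*↧x σ {+ 1 ℤ.- + P} {d ℕ.* P} σdP≡1-P) ⟩
      ℤ.∣ (+ 1 ℤ.- + P) ℤ.* ↧ σ ∣    ≡⟨ ℤ.abs-* (+ 1 ℤ.- + P) (↧ σ) ⟩
      ℤ.∣ + 1 ℤ.- + P ∣ ℕ.* x        ≡⟨ cong (ℕ._* x) ∣1-P∣≡P-1 ⟩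
      (P ∸ 1) ℕ.* x                  ∎
      where open ≡-Reasoning
    P∣[P-1]*x : P ∣ (P ∸ 1) ℕ.* x
    P∣[P-1]*x = subst (P ∣_) cross (∣n⇒∣m*n ℤ.∣ ↥ σ ∣ (n∣m*n d))
    P*x≡ : P ℕ.* x ≡ (P ∸ 1) ℕ.* x ℕ.+ x
    P*x≡ = trans (cong (ℕ._* x) (sym (ℕ.m+[n∸m]≡n 1≤P))) (ℕ.+-comm x ((P ∸ 1) ℕ.* x))

module ExponentialPolygon (q : ℕ) (p-prime : Prime (suc (suc q))) {n bs} (1≤n : 1 ℕ.≤ n)
  (isExpansion : IsBaseRep n (suc (suc q)) bs) where
  open import Data.Nat as ℕ using (z≤n; s≤s; _^_; _∸_)
  import Data.Nat.Properties as ℕ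
  open import Data.Nat.Divisibility using (_∣_; ∣-trans)
  open import Data.Integer as ℤ using (+_)
  open import Data.Rational as ℚ using (_+_; _*_; _-_; -_; 0ℚ; 1ℚ; 1/_; _≤_; _<_; ↧ₙ_)
  import Data.Rational.Properties as ℚ
  open import Data.Product using (_,_; proj₁; proj₂)
  open import Relation.Binary.PropositionalEquality
  open Embedding
  open SlopeArithmetic
  open NewtonPolygon using (module ConvexMinorant)

  open Valuation q
  open DigitSum q
  open Expansion q
  open Pivots isExpansion
  open RationalValuation q p-prime

  S T Z : ℕ → ℚ
  S j = ℕ→ℚ (digitSum j)
  T j = ℕ→ℚ (νℕ p (j ℕ.!))
  Z j = - T j

  δ : ℚ
  δ = ℕ→ℚ (p ∸ 1)

  P : ℕ → ℚ
  P e = ℕ→ℚ (p ^ e)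

  0<δP : ∀ e → 0ℚ < δ * P e
  0<δP e = subst (0ℚ <_) (ℕ→ℚ-homo-* (p ∸ 1) (p ^ e)) (0<ℕ→ℚ {(p ∸ 1) ℕ.* p ^ e} (ℕ.*-mono-≤ {1} {p ∸ 1} (s≤s z≤n) (ℕ.m^n>0 p e)))

  δP≢0 : ∀ e → ℚ.NonZero (δ * P e)
  δP≢0 e = ℚ.pos⇒nonZero (δ * P e) {{ℚ.positive (0<δP e)}}

  slope : ℕ → ℚ
  slope e = (1ℚ - P e) * (1/ (δ * P e)) {{δP≢0 e}}

  slope*δP≡1-P : ∀ e → slope e * (δ * P e) ≡ 1ℚ - P e
  slope*δP≡1-P e = trans (ℚ.*-assoc (1ℚ - P e) ((1/ (δ * P e)) {{δP≢0 e}}) (δ * P e))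
    (trans (cong ((1ℚ - P e) *_) (ℚ.*-inverseˡ (δ * P e) {{δP≢0 e}})) (ℚ.*-identityʳ (1ℚ - P e)))

  μ : ℕ → ℚ
  μ i = slope (e i)

  module EdgeOf (e : ℕ) = Edge δ (P e) (slope e) (0<δP e) (slope*δP≡1-P e)

  legendre-ℚ : ∀ j → S j + δ * T j ≡ ℕ→ℚ j
  legendre-ℚ j = trans (cong (λ x → S j + x) (sym (ℕ→ℚ-homo-* (p ∸ 1) (νℕ p (j ℕ.!)))))
    (trans (sym (ℕ→ℚ-homo-+ (digitSum j) ((p ∸ 1) ℕ.* νℕ p (j ℕ.!)))) (cong ℕ→ℚ (legendre p-prime j)))

  line-below : ∀ i → i ℕ.< s → ∀ j → j ℕ.≤ n → Z (k i) + μ i * (ℕ→ℚ j - ℕ→ℚ (k i)) ≤ Z j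
  line-below i i<s j j≤n = EdgeOf.line-below (e i) (S (k i)) (S j) (T (k i)) (T j) (legendre-ℚ (k i)) (legendre-ℚ j)
    (subst₂ _≤_ (ℕ→ℚ[a*b+c] (p ^ e i) (digitSum (k i)) j) (ℕ→ℚ[a*b+c] (p ^ e i) (digitSum j) (k i))
      (ℕ→ℚ-mono-≤ (p^e*digitSum[K]+j≤p^e*digitSum[j]+K (e i) (k i) j p^[1+e]∣pivot (ℕ.≤-<-trans j≤n (n<k+p^[1+e] i i<s)))))
    where
    open PivotStep (step i i<s)
    ℕ→ℚ[a*b+c] : ∀ a b c → ℕ→ℚ (a ℕ.* b ℕ.+ c) ≡ ℕ→ℚ a * ℕ→ℚ b + ℕ→ℚ c
    ℕ→ℚ[a*b+c] a b c = trans (ℕ→ℚ-homo-+ (a ℕ.* b) c) (cong (_+ ℕ→ℚ c) (ℕ→ℚ-homo-* a b))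

  line-through : ∀ i → i ℕ.< s → Z (k (suc i)) ≡ Z (k i) + μ i * (ℕ→ℚ (k (suc i)) - ℕ→ℚ (k i))
  line-through i i<s = begin
    Z (k (suc i))                                      ≡⟨ EdgeOf.line-through (e i) (S (k i)) (T (k i)) (T (k (suc i))) b (legendre-ℚ (k i)) legendre′ ⟩
    Z (k i) + μ i * ((ℕ→ℚ (k i) + b * P (e i)) - ℕ→ℚ (k i)) ≡⟨ cong (λ x → Z (k i) + μ i * (x - ℕ→ℚ (k i))) K′≡ ⟨
    Z (k i) + μ i * (ℕ→ℚ (k (suc i)) - ℕ→ℚ (k i))     ∎
    where
    open ≡-Reasoning
    open PivotStep (step i i<s)
    b = ℕ→ℚ (digit bs i)
    K′≡ : ℕ→ℚ (k (suc i)) ≡ ℕ→ℚ (k i) + b * P (e i)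
    K′≡ = trans (cong ℕ→ℚ pivot-suc) (trans (ℕ→ℚ-homo-+ (k i) (digit bs i ℕ.* p ^ e i)) (cong (λ x → ℕ→ℚ (k i) + x) (ℕ→ℚ-homo-* (digit bs i) (p ^ e i))))
    S[K′] : S (k (suc i)) ≡ S (k i) + b
    S[K′] = trans (cong S pivot-suc)
      (trans (cong ℕ→ℚ (digitSum[K+b*p^e]≡digitSum[K]+b (e i) (k i) (digit bs i) p^[1+e]∣pivot (proj₂ isDigit)))
        (ℕ→ℚ-homo-+ (digitSum (k i)) (digit bs i)))
    legendre′ : (S (k i) + b) + δ * T (k (suc i)) ≡ ℕ→ℚ (k i) + b * P (e i)
    legendre′ = trans (cong (_+ δ * T (k (suc i))) (sym S[K′])) (trans (legendre-ℚ (k (suc i))) K′≡)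

  μ-increasing : ∀ i → suc i ℕ.< s → μ i < μ (suc i)
  μ-increasing i 1+i<s = slope-increasing {μ = μ i} {μ′ = μ (suc i)}
    (0<ℕ→ℚ {p ∸ 1} (s≤s z≤n)) (0<ℕ→ℚ (ℕ.m^n>0 p (e (suc i))))
    (ℕ→ℚ-mono-< (ℕ.^-monoʳ-< p (s≤s (s≤s z≤n)) (exponent-< i 1+i<s)))
    (slope*δP≡1-P (e i)) (slope*δP≡1-P (e (suc i)))

  open ConvexMinorant p n 1≤n Z s k μ refl k[s]≡n k<k[1+i] line-below line-through μ-increasing public

  vert-hcoeff : ∀ a j → a j ≢ 0ℚ → vert p (hcoeff a) j ≡ ℤ→ℚ (ordℚ p (a j)) + Z j
  vert-hcoeff a j aj≢0 = begin
    ℤ→ℚ (ordℚ p (hcoeff a j))                          ≡⟨ cong ℤ→ℚ (ordℚ-hcoeff a j aj≢0) ⟩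
    ℤ→ℚ (ordℚ p (a j) ℤ.+ ℤ.- + νℕ p (j ℕ.!))          ≡⟨ ℤ→ℚ-homo-+ (ordℚ p (a j)) (ℤ.- + νℕ p (j ℕ.!)) ⟩
    ℤ→ℚ (ordℚ p (a j)) + ℤ→ℚ (ℤ.- + νℕ p (j ℕ.!))      ≡⟨ cong (λ x → ℤ→ℚ (ordℚ p (a j)) + x) (ℤ→ℚ-homo‿- (+ νℕ p (j ℕ.!))) ⟩
    ℤ→ℚ (ordℚ p (a j)) + Z j                           ∎
    where open ≡-Reasoning

  knot-isPivotal : ∀ i → i ℕ.≤ s → IsPivotal n p (k i)
  knot-isPivotal i i≤s = bs , isExpansion , i , i≤s , refl

  E-supported : Supports (hcoeff Ecoeff)
  E-supported = record
    { above   = λ j _ _ → ℚ.≤-reflexive (sym (vert-E j))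
    ; knot≢0  = λ i _ → hcoeff-≢0 Ecoeff (k i) 1ℚ≢0
    ; on-knot = λ i _ → vert-E (k i)
    }
    where
    1ℚ≢0 : 1ℚ ≢ 0ℚ
    1ℚ≢0 ()
    vert-E : ∀ j → vert p (hcoeff Ecoeff) j ≡ Z j
    vert-E j = begin
      vert p (hcoeff Ecoeff) j      ≡⟨ vert-hcoeff Ecoeff j 1ℚ≢0 ⟩
      ℤ→ℚ (ordℚ p 1ℚ) + Z j         ≡⟨ cong (_+ Z j) ℕ→ℚ[0]≡0 ⟩
      0ℚ + Z j                      ≡⟨ ℚ.+-identityˡ (Z j) ⟩
      Z j                           ∎
      where open ≡-Reasoning

  coleman-supported : ∀ {a} → ColemanIntegral p n a → Supports (hcoeff a)
  coleman-supported {a} (hurwitz , pivotal) = record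
    { above   = above
    ; knot≢0  = λ i i≤s → hcoeff-≢0 a (k i) (proj₁ (pivotal (k i) (knot-isPivotal i i≤s)))
    ; on-knot = on-knot
    }
    where
    above : ∀ j → j ℕ.≤ n → hcoeff a j ≢ 0ℚ → Z j ≤ vert p (hcoeff a) j
    above j j≤n hj≢0 = begin
      Z j                           ≡⟨ ℚ.+-identityˡ (Z j) ⟨
      0ℚ + Z j                      ≤⟨ ℚ.+-monoˡ-≤ (Z j) 0≤ord ⟩
      ℤ→ℚ (ordℚ p (a j)) + Z j      ≡⟨ vert-hcoeff a j aj≢0 ⟨
      vert p (hcoeff a) j           ∎
      where
      open ℚ.≤-Reasoning
      aj≢0 = hcoeff-≢0⁻ a j hj≢0
      0≤ord : 0ℚ ≤ ℤ→ℚ (ordℚ p (a j))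
      0≤ord = subst (_≤ ℤ→ℚ (ordℚ p (a j))) ℕ→ℚ[0]≡0 (ℤ→ℚ-mono-≤ (hurwitz j j≤n aj≢0))
    on-knot : ∀ i → i ℕ.≤ s → vert p (hcoeff a) (k i) ≡ Z (k i)
    on-knot i i≤s = begin
      vert p (hcoeff a) (k i)       ≡⟨ vert-hcoeff a (k i) ak≢0 ⟩
      ℤ→ℚ (ordℚ p (a (k i))) + Z (k i) ≡⟨ cong (λ z → ℤ→ℚ z + Z (k i)) ord≡0 ⟩
      ℤ→ℚ (+ 0) + Z (k i)           ≡⟨ cong (_+ Z (k i)) ℕ→ℚ[0]≡0 ⟩
      0ℚ + Z (k i)                  ≡⟨ ℚ.+-identityˡ (Z (k i)) ⟩
      Z (k i)                       ∎
      where
      open ≡-Reasoning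
      ak≢0   = proj₁ (pivotal (k i) (knot-isPivotal i i≤s))
      ord≡0  = proj₂ (pivotal (k i) (knot-isPivotal i i≤s))

  p^νℕ[n]∣↧slope : ∀ {c} → Supports c → ∀ i → i ℕ.< s → ∀ σ →
    σ * (ℕ→ℚ (k (suc i)) - ℕ→ℚ (k i)) ≡ vert p c (k (suc i)) - vert p c (k i) → p ^ νℕ p n ∣ ↧ₙ σ
  p^νℕ[n]∣↧slope supp i i<s σ rise = ∣-trans (^-monoʳ-∣ p (νℕ[n]≤e i i<s))
    (σ*dP≡1-P⇒P∣↧σ {σ} {p ∸ 1} (ℕ.m^n>0 p (e i)) (begin
      σ * ℕ→ℚ ((p ∸ 1) ℕ.* p ^ e i)  ≡⟨ cong₂ _*_ (edge-slope supp i i<s σ rise) (ℕ→ℚ-homo-* (p ∸ 1) (p ^ e i)) ⟩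
      μ i * (δ * P (e i))            ≡⟨ slope*δP≡1-P (e i) ⟩
      1ℚ - P (e i)                   ≡⟨ cong (_- P (e i)) ℕ→ℚ[1]≡1 ⟨
      ℕ→ℚ 1 - P (e i)                ≡⟨ ℤ→ℚ[+m-+n]≡ℕ→ℚ[m]-ℕ→ℚ[n] 1 (p ^ e i) ⟨
      ℤ→ℚ (+ 1 ℤ.- + p ^ e i)        ∎))
    where open ≡-Reasoning

  isBreak⇒isPivotal : ∀ {c j} → Supports c → IsBreak p c n j → IsPivotal n p j
  isBreak⇒isPivotal supp isBreak =
    let i , i≤s , j≡k = isBreak⇒knot supp isBreak
    in subst (IsPivotal n p) (sym j≡k) (knot-isPivotal i i≤s)

  p^νℕ[n]∣↧slope-between : ∀ {c b b′} → Supports c → ConsecutiveBreaks p c n b b′ → ∀ σ →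
    σ * (ℕ→ℚ b′ - ℕ→ℚ b) ≡ vert p c b′ - vert p c b → p ^ νℕ p n ∣ ↧ₙ σ
  p^νℕ[n]∣↧slope-between {c} supp consecutive σ rise =
    let i , i<s , b≡k , b′≡k′ = consecutiveBreaks⇒edge supp consecutive
    in p^νℕ[n]∣↧slope supp i i<s σ (subst₂ (λ u v → σ * (ℕ→ℚ v - ℕ→ℚ u) ≡ vert p c v - vert p c u) b≡k b′≡k′ rise)

open import Data.Nat using (ℕ; suc; _≤_; _^_)
open import Data.Nat.Primality using (Prime)
open import Data.Nat.Divisibility using (_∣_)
open import Data.Rational using (ℚ; 0ℚ; _*_; _-_; ↧ₙ_)
open import Data.Product using (_×_; _,_; proj₂)
open import Relation.Binary.PropositionalEquality using (_≡_; _≢_; sym; subst)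
open import Function.Bundles using (_⇔_; mk⇔)

lemma2p6 : (p : ℕ) → Prime p → (n : ℕ) → 1 ≤ n → (a : ℕ → ℚ) → a n ≢ 0ℚ →
    ColemanIntegral p n a →
    SameNP p (hcoeff a) (hcoeff Ecoeff) n
    × (∀ j → IsBreak p (hcoeff a) n j ⇔ IsPivotal n p j)
    × (∀ b b' → ConsecutiveBreaks p (hcoeff a) n b b' →
         ∀ s → s * (ℕ→ℚ b' - ℕ→ℚ b) ≡ vert p (hcoeff a) b' - vert p (hcoeff a) b →
         p ^ νℕ p n ∣ ↧ₙ s)
lemma2p6 0 ()
lemma2p6 1 ()
lemma2p6 (suc (suc q)) p-prime n 1≤n a _ coleman =
  (λ x y → mk⇔ (npValue-transfer a-supported E-supported) (npValue-transfer E-supported a-supported)) ,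
  (λ j → mk⇔ (isBreak⇒isPivotal a-supported) isPivotal⇒isBreak) ,
  (λ b b′ → p^νℕ[n]∣↧slope-between a-supported)
  where
  module Polygon {bs} (isExpansion : IsBaseRep n (suc (suc q)) bs) = ExponentialPolygon q p-prime 1≤n isExpansion
  open Polygon (proj₂ (Expansion.expansion q n))
  a-supported = coleman-supported coleman

  -- A pivotal index comes with its own expansion of n; the polygon built from that expansion
  -- serves just as well.
  isPivotal⇒isBreak : ∀ {j} → IsPivotal n (suc (suc q)) j → IsBreak (suc (suc q)) (hcoeff a) n j
  isPivotal⇒isBreak (_ , isExpansion , i , i≤s , j≡k) = subst (IsBreak (suc (suc q)) (hcoeff a) n) (sym j≡k)
    (Polygon.knot-isBreak isExpansion (Polygon.coleman-supported isExpansion coleman) i i≤s)
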